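{- Let $\mathbb M_2$ be the set of non-negative elements of the ordered ring $\mathbb Q[\mathsf X]\cdot\mathsf X+\mathbb Z$. Every $2\times 2$ matrix with entries in $\mathbb M_2$ and determinant $1$ can be written uniquely as a finite alternating product of matrices of the forms $\mathtt A^P=\begin{pmatrix}1&P\\0&1\end{pmatrix}$ and $\mathtt B^Q=\begin{pmatrix}1&0\\Q&1\end{pmatrix}$ with $P,Q$ non-zero elements of $\mathbb M_2$ (the empty product giving the identity matrix).
   Context: $\mathbb Q[\mathsf X]\cdot\mathsf X+\mathbb Z$ is the ring of polynomials in $\mathsf X$ with rational coefficients and integer constant term, ordered by: a non-zero polynomial is positive iff its leading coefficient is positive. "Alternating" means that consecutive factors are not both of the $\mathtt A$-form nor both of the $\mathtt B$-form. -}

module Defs where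

open import Data.Nat as ℕ using (ℕ; zero; suc)
open import Data.Integer as ℤ using (ℤ)
open import Data.Rational as ℚ using (ℚ; 0ℚ; 1ℚ)
open import Data.List using (List; []; _∷_; foldr)
open import Data.List.Relation.Unary.All using (All)
open import Data.List.Relation.Binary.Pointwise using (Pointwise)
open import Data.Product using (Σ; ∃; _×_; _,_)
open import Data.Sum using (_⊎_)
open import Data.Empty using (⊥)
open import Data.Unit using (⊤)
open import Relation.Nullary using (¬_)
open import Relation.Binary.PropositionalEquality using (_≡_)

-- Polynomials with rational coefficients, as raw coefficient lists
-- (lowest degree first).  Equality is coefficientwise (so trailing
-- zeros are irrelevant).

Poly : Set
Poly = List ℚ

coeff : Poly → ℕ → ℚ
coeff []       _       = 0ℚ
coeff (a ∷ p)  zero    = a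
coeff (a ∷ p)  (suc n) = coeff p n

infix 4 _≈ₚ_
_≈ₚ_ : Poly → Poly → Set
p ≈ₚ q = ∀ n → coeff p n ≡ coeff q n

0ₚ 1ₚ : Poly
0ₚ = []
1ₚ = 1ℚ ∷ []

infixl 6 _+ₚ_ _-ₚ_
infixl 7 _*ₚ_ _·ₚ_

_+ₚ_ : Poly → Poly → Poly
[]      +ₚ q       = q
(a ∷ p) +ₚ []      = a ∷ p
(a ∷ p) +ₚ (b ∷ q) = (a ℚ.+ b) ∷ (p +ₚ q)

_·ₚ_ : ℚ → Poly → Poly
c ·ₚ []      = []
c ·ₚ (a ∷ p) = (c ℚ.* a) ∷ (c ·ₚ p)

-ₚ_ : Poly → Poly
-ₚ p = ℚ.- 1ℚ ·ₚ p

_-ₚ_ : Poly → Poly → Poly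
p -ₚ q = p +ₚ (-ₚ q)

-- (a + X p) * q = a q + X (p q)
_*ₚ_ : Poly → Poly → Poly
[]      *ₚ q = []
(a ∷ p) *ₚ q = (a ·ₚ q) +ₚ (0ℚ ∷ (p *ₚ q))

-- The ring Q[X]·X + Z : polynomials with integer constant term,
-- ordered by the sign of the leading coefficient.

IntConst : Poly → Set
IntConst p = ∃ λ (z : ℤ) → coeff p 0 ≡ z ℚ./ 1

NonNeg : Poly → Set
NonNeg p = (p ≈ₚ 0ₚ)
         ⊎ (∃ λ d → (0ℚ ℚ.< coeff p d) × (∀ m → d ℕ.< m → coeff p m ≡ 0ℚ))

InM₂ : Poly → Set
InM₂ p = IntConst p × NonNeg p

record Mat : Set where
  constructor mat
  field a b c d : Poly

open Mat public

infix 4 _≈ₘ_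
_≈ₘ_ : Mat → Mat → Set
M ≈ₘ N = (a M ≈ₚ a N) × (b M ≈ₚ b N) × (c M ≈ₚ c N) × (d M ≈ₚ d N)

infixl 7 _*ₘ_
_*ₘ_ : Mat → Mat → Mat
mat a₁ b₁ c₁ d₁ *ₘ mat a₂ b₂ c₂ d₂ =
  mat (a₁ *ₚ a₂ +ₚ b₁ *ₚ c₂) (a₁ *ₚ b₂ +ₚ b₁ *ₚ d₂)
      (c₁ *ₚ a₂ +ₚ d₁ *ₚ c₂) (c₁ *ₚ b₂ +ₚ d₁ *ₚ d₂)

Iₘ : Mat
Iₘ = mat 1ₚ 0ₚ 0ₚ 1ₚ

det : Mat → Poly
det (mat a b c d) = a *ₚ d -ₚ b *ₚ c

EntriesInM₂ : Mat → Set
EntriesInM₂ (mat a b c d) = InM₂ a × InM₂ b × InM₂ c × InM₂ d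

data Factor : Set where
  A : Poly → Factor
  B : Poly → Factor

toMat : Factor → Mat
toMat (A P) = mat 1ₚ P 0ₚ 1ₚ
toMat (B Q) = mat 1ₚ 0ₚ Q 1ₚ

param : Factor → Poly
param (A P) = P
param (B Q) = Q

prod : List Factor → Mat
prod = foldr (λ f M → toMat f *ₘ M) Iₘ

infix 4 _≈F_
_≈F_ : Factor → Factor → Set
A P ≈F A P' = P ≈ₚ P'
B Q ≈F B Q' = Q ≈ₚ Q'
A _ ≈F B _  = ⊥
B _ ≈F A _  = ⊥

SameForm : Factor → Factor → Set
SameForm (A _) (A _) = ⊤
SameForm (B _) (B _) = ⊤
SameForm _     _     = ⊥

Alternating : List Factor → Set
Alternating []           = ⊤
Alternating (f ∷ [])     = ⊤
Alternating (f ∷ g ∷ fs) = ¬ SameForm f g × Alternating (g ∷ fs)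

GoodFactor : Factor → Set
GoodFactor f = InM₂ (param f) × ¬ (param f ≈ₚ 0ₚ)

ValidWord : List Factor → Set
ValidWord fs = Alternating fs × All GoodFactor fs

-- Call M = (a b ; c d) of A-type if c ≤ a and d ≤ b, and of B-type if a ≤ c and b ≤ d.
-- The order of 𝕄₂ is discrete (1 is its least positive element), so A^P N is of A-type whenever
-- P ≠ 0 and N has entries in 𝕄₂; and a matrix of SL₂(𝕄₂) is either the identity, of A-type, or
-- of B-type, exclusively. Hence the type of M determines the form of the first factor, and
-- A^P N = A^P′ N′ with N, N′ the identity or of B-type forces P = P′, since otherwise N or N′
-- would be of A-type; this gives uniqueness by induction on the word.
--
-- For existence, peel a factor A^P off a matrix M of A-type (B-type is symmetric, by conjugating
-- with the antidiagonal matrix) and recurse on A^-P M, measured lexicographically by a bound D on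
-- the degrees of the entries and the sum of the degree-D coefficients. If c or d has degree D,
-- peeling A¹ lowers that sum by at least 1/k, where k clears all denominators. Otherwise a or b
-- has degree D, and det M = 1 forces deg a - deg c = deg b - deg d = e + 1 with proportional
-- leading coefficients, so P = μ X^(e+1) - T X^e lowers the degrees of both a and b.

module Submission where

open import Defs
open import Algebra.Bundles using (CommutativeRing; CommutativeSemigroup)
import Algebra.Properties.CommutativeSemigroup as CommSemigroupProperties
open import Data.Empty using (⊥; ⊥-elim)
open import Data.Integer as ℤ using (ℤ; +_; -[1+_])
import Data.Integer.Properties as ℤP
open import Data.List using (List; []; _∷_; length)
open import Data.List.Relation.Binary.Pointwise using (Pointwise; []; _∷_)
open import Data.List.Relation.Unary.All using (All; []; _∷_)
open import Data.Maybe using (Maybe; just; nothing)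
open import Data.Nat as ℕ using (ℕ; zero; suc; _⊔_)
import Data.Nat.Coprimality as Coprime
open import Data.Nat.Induction using (<-rec)
import Data.Nat.Properties as ℕP
open import Data.Product as Product using (_×_; _,_; Σ; ∃; proj₁; proj₂)
open import Data.Rational as ℚ using (ℚ; 0ℚ; 1ℚ; mkℚ)
import Data.Rational.Properties as ℚP
import Data.Rational.Unnormalised as ℚᵘ
import Data.Rational.Unnormalised.Properties as ℚᵘP
open import Data.Sum as Sum using (_⊎_; inj₁; inj₂; [_,_]′; map₁)
open import Data.Unit using (tt)
open import Function using (_∘_)
open import Relation.Binary using (tri<; tri≈; tri>)
open import Relation.Binary.PropositionalEquality
open import Relation.Nullary using (¬_; Dec; yes; no)
import Relation.Nullary.Decidable as Dec
open import Tactic.RingSolver using (solve-∀)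
open import Tactic.RingSolver.Core.AlmostCommutativeRing using (AlmostCommutativeRing; fromCommutativeRing)

ℚ-acr : AlmostCommutativeRing _ _
ℚ-acr = fromCommutativeRing ℚP.+-*-commutativeRing (λ x → Dec.dec⇒maybe (0ℚ ℚP.≟ x))

-1*x≡-x : ∀ x → ℚ.- 1ℚ ℚ.* x ≡ ℚ.- x
-1*x≡-x = solve-∀ ℚ-acr

>0⇒≢0 : ∀ {x} → 0ℚ ℚ.< x → x ≢ 0ℚ
>0⇒≢0 x>0 x≡0 = ℚP.<-irrefl (sym x≡0) x>0

pos+pos : ∀ {x y} → 0ℚ ℚ.< x → 0ℚ ℚ.< y → 0ℚ ℚ.< x ℚ.+ y
pos+pos {x} {y} x>0 y>0 = subst (ℚ._< x ℚ.+ y) (ℚP.+-identityˡ 0ℚ) (ℚP.+-mono-< x>0 y>0)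

nonNeg+nonNeg : ∀ {x y} → 0ℚ ℚ.≤ x → 0ℚ ℚ.≤ y → 0ℚ ℚ.≤ x ℚ.+ y
nonNeg+nonNeg {x} {y} x≥0 y≥0 = subst (ℚ._≤ x ℚ.+ y) (ℚP.+-identityˡ 0ℚ) (ℚP.+-mono-≤ x≥0 y≥0)

pos*pos : ∀ {x y} → 0ℚ ℚ.< x → 0ℚ ℚ.< y → 0ℚ ℚ.< x ℚ.* y
pos*pos {x} {y} x>0 y>0 =
  ℚP.positive⁻¹ (x ℚ.* y) {{ℚP.pos*pos⇒pos x {{ℚ.positive x>0}} y {{ℚ.positive y>0}}}}

nonNeg*pos : ∀ {x y} → 0ℚ ℚ.≤ x → 0ℚ ℚ.< y → 0ℚ ℚ.≤ x ℚ.* y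
nonNeg*pos {x} {y} x≥0 y>0 =
  subst (ℚ._≤ x ℚ.* y) (ℚP.*-zeroˡ y) (ℚP.*-monoʳ-≤-nonNeg y {{ℚ.nonNegative (ℚP.<⇒≤ y>0)}} x≥0)

nonNeg+nonNeg-cases : ∀ {x y} → 0ℚ ℚ.≤ x → 0ℚ ℚ.≤ y → 0ℚ ℚ.< x ℚ.+ y ⊎ (x ≡ 0ℚ × y ≡ 0ℚ)
nonNeg+nonNeg-cases {x} {y} x≥0 y≥0 with ℚP.<-cmp 0ℚ (x ℚ.+ y)
... | tri< x+y>0 _ _ = inj₁ x+y>0
... | tri> _ _ x+y<0 = ⊥-elim (ℚP.<-irrefl refl (ℚP.<-≤-trans x+y<0 (nonNeg+nonNeg x≥0 y≥0)))
... | tri≈ _ 0≡x+y _ =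
  inj₂ (ℚP.≤-antisym (subst₂ ℚ._≤_ (ℚP.+-identityʳ x) (sym 0≡x+y) (ℚP.+-monoʳ-≤ x y≥0)) x≥0 ,
        ℚP.≤-antisym (subst₂ ℚ._≤_ (ℚP.+-identityˡ y) (sym 0≡x+y) (ℚP.+-monoˡ-≤ y x≥0)) y≥0)

*-cancelʳ-pos : ∀ {x y z} → 0ℚ ℚ.< z → x ℚ.* z ≡ y ℚ.* z → x ≡ y
*-cancelʳ-pos {x} {y} {z} z>0 xz≡yz = begin
  x                       ≡⟨ divide x ⟨
  x ℚ.* z ℚ.* ℚ.1/ z      ≡⟨ cong (ℚ._* ℚ.1/ z) xz≡yz ⟩
  y ℚ.* z ℚ.* ℚ.1/ z      ≡⟨ divide y ⟩
  y                       ∎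
  where
  open ≡-Reasoning
  instance
    z≢0 : ℚ.NonZero z
    z≢0 = ℚ.>-nonZero z>0
  divide : ∀ w → w ℚ.* z ℚ.* ℚ.1/ z ≡ w
  divide w = trans (ℚP.*-assoc w z (ℚ.1/ z)) (trans (cong (w ℚ.*_) (ℚP.*-inverseʳ z)) (ℚP.*-identityʳ w))

fromℤ : ℤ → ℚ
fromℤ z = z ℚ./ 1

-- IntConst p from Defs unfolds to Integral (coeff p 0).
Integral : ℚ → Set
Integral x = ∃ λ z → x ≡ fromℤ z

mkℚ/1 : ℤ → ℚ
mkℚ/1 z = mkℚ z 0 (Coprime.sym (Coprime.1-coprimeTo _))

fromℤ≡mkℚ : ∀ z → fromℤ z ≡ mkℚ/1 z
fromℤ≡mkℚ z = ℚP.↥p/↧p≡p (mkℚ/1 z)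

fromℤ-+ : ∀ z w → fromℤ z ℚ.+ fromℤ w ≡ fromℤ (z ℤ.+ w)
fromℤ-+ z w rewrite fromℤ≡mkℚ z | fromℤ≡mkℚ w =
  cong₂ (λ x y → (x ℤ.+ y) ℚ./ 1) (ℤP.*-identityʳ z) (ℤP.*-identityʳ w)

fromℤ-* : ∀ z w → fromℤ z ℚ.* fromℤ w ≡ fromℤ (z ℤ.* w)
fromℤ-* z w rewrite fromℤ≡mkℚ z | fromℤ≡mkℚ w = refl

fromℤ-neg : ∀ z → ℚ.- fromℤ z ≡ fromℤ (ℤ.- z)
fromℤ-neg z rewrite fromℤ≡mkℚ z | fromℤ≡mkℚ (ℤ.- z) = neg-mkℚ z
  where
  neg-mkℚ : ∀ z → ℚ.- mkℚ/1 z ≡ mkℚ/1 (ℤ.- z)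
  neg-mkℚ (+ zero)  = refl
  neg-mkℚ (+ suc n) = refl
  neg-mkℚ -[1+ n ]  = refl

fromℤ-mono-< : ∀ {z w} → z ℤ.< w → fromℤ z ℚ.< fromℤ w
fromℤ-mono-< {z} {w} z<w rewrite fromℤ≡mkℚ z | fromℤ≡mkℚ w =
  ℚ.*<* (subst₂ ℤ._<_ (sym (ℤP.*-identityʳ z)) (sym (ℤP.*-identityʳ w)) z<w)

fromℤ-mono-≤ : ∀ {z w} → z ℤ.≤ w → fromℤ z ℚ.≤ fromℤ w
fromℤ-mono-≤ {z} {w} z≤w rewrite fromℤ≡mkℚ z | fromℤ≡mkℚ w =
  ℚ.*≤* (subst₂ ℤ._≤_ (sym (ℤP.*-identityʳ z)) (sym (ℤP.*-identityʳ w)) z≤w)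

fromℤ-cancel-< : ∀ {z w} → fromℤ z ℚ.< fromℤ w → z ℤ.< w
fromℤ-cancel-< {z} {w} x<y rewrite fromℤ≡mkℚ z | fromℤ≡mkℚ w with x<y
... | ℚ.*<* z*1<w*1 = subst₂ ℤ._<_ (ℤP.*-identityʳ z) (ℤP.*-identityʳ w) z*1<w*1

Integral-+ : ∀ {x y} → Integral x → Integral y → Integral (x ℚ.+ y)
Integral-+ (z , refl) (w , refl) = z ℤ.+ w , fromℤ-+ z w

Integral-* : ∀ {x y} → Integral x → Integral y → Integral (x ℚ.* y)
Integral-* (z , refl) (w , refl) = z ℤ.* w , fromℤ-* z w

Integral-neg : ∀ {x} → Integral x → Integral (ℚ.- x)
Integral-neg (z , refl) = ℤ.- z , fromℤ-neg z

Integral-minus : ∀ {x y} → Integral x → Integral y → Integral (x ℚ.- y)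
Integral-minus ix iy = Integral-+ ix (Integral-neg iy)

Integral-pos⇒≥1 : ∀ {x} → Integral x → 0ℚ ℚ.< x → 1ℚ ℚ.≤ x
Integral-pos⇒≥1 (z , refl) x>0 with fromℤ-cancel-< {+ 0} {z} x>0
... | ℤ.+<+ {n = suc n} _ = fromℤ-mono-≤ {+ 1} {+ suc n} (ℤ.+≤+ (ℕ.s≤s ℕ.z≤n))

fromℕ : ℕ → ℚ
fromℕ n = fromℤ (+ n)

fromℕ-* : ∀ k m → fromℕ k ℚ.* fromℕ m ≡ fromℕ (k ℕ.* m)
fromℕ-* k m = trans (fromℤ-* (+ k) (+ m)) (cong fromℤ (sym (ℤP.pos-* k m)))

fromℕ-pos : ∀ {k} → 0 ℕ.< k → 0ℚ ℚ.< fromℕ k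
fromℕ-pos k>0 = fromℤ-mono-< (ℤ.+<+ k>0)

archimedean : ∀ x → ∃ λ n → x ℚ.< fromℕ n
archimedean (mkℚ (+ n) d _) = suc n , x<n+1
  where
  x<n+1 : mkℚ (+ n) d _ ℚ.< fromℕ (suc n)
  x<n+1 rewrite fromℤ≡mkℚ (+ suc n) =
    ℚ.*<* (subst₂ ℤ._<_ (sym (ℤP.*-identityʳ (+ n))) (ℤP.pos-* (suc n) (suc d))
                        (ℤ.+<+ (ℕP.<-≤-trans (ℕP.n<1+n n) (ℕP.m≤m*n (suc n) (suc d)))))
archimedean (mkℚ -[1+ n ] d _) = 0 , ℚ.*<* ℤ.-<+

fromℕ-bound-decrease : ∀ {s t x} f → s ℚ.+ x ≡ t → 1ℚ ℚ.≤ x → 0ℚ ℚ.≤ s → t ℚ.≤ fromℕ f →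
                ∃ λ f′ → f ≡ suc f′ × s ℚ.≤ fromℕ f′
fromℕ-bound-decrease {s} {t} {x} zero s+x≡t x≥1 s≥0 t≤0 =
  ⊥-elim (ℚP.<-irrefl refl (ℚP.<-≤-trans (ℚP.positive⁻¹ 1ℚ) (ℚP.≤-trans x≥1 (ℚP.≤-trans x≤t t≤0))))
  where
  x≤t : x ℚ.≤ t
  x≤t = subst₂ ℚ._≤_ (ℚP.+-identityˡ x) s+x≡t (ℚP.+-monoˡ-≤ x s≥0)
fromℕ-bound-decrease {s} {t} {x} (suc f) s+x≡t x≥1 s≥0 t≤f+1 = f , refl ,
  subst₂ ℚ._≤_ (trans (cong (ℚ._- x) (sym s+x≡t)) (cancel s x))
               (trans (cong (ℚ._- 1ℚ) f+1) (cancel (fromℕ f) 1ℚ))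
               (ℚP.+-mono-≤ t≤f+1 (ℚP.neg-antimono-≤ x≥1))
  where
  cancel : ∀ y z → (y ℚ.+ z) ℚ.- z ≡ y
  cancel = solve-∀ ℚ-acr
  f+1 : fromℕ (suc f) ≡ fromℕ f ℚ.+ 1ℚ
  f+1 = trans (cong fromℤ (cong +_ (ℕP.+-comm 1 f))) (sym (fromℤ-+ (+ f) (+ 1)))

record ClearedBy (k : ℕ) (x : ℚ) : Set where
  constructor cleared
  field integral : Integral (x ℚ.* fromℕ k)
open ClearedBy public

ClearedBy-denominator : ∀ x → ClearedBy (ℚ.↧ₙ x) x
ClearedBy-denominator x@(mkℚ n d _) = cleared (n , (begin
  x ℚ.* fromℕ (suc d)    ≡⟨ cong (x ℚ.*_) (fromℤ≡mkℚ (+ suc d)) ⟩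
  x ℚ.* mkℚ/1 (+ suc d)  ≡⟨ ℚP.toℚᵘ-injective (ℚᵘP.≃-trans (ℚP.toℚᵘ-homo-* x (mkℚ/1 (+ suc d)))
                                                         (ℚᵘ.*≡* n*[d+1]*1≡n*[d*1+1])) ⟩
  mkℚ/1 n                ≡⟨ fromℤ≡mkℚ n ⟨
  fromℤ n                ∎))
  where
  open ≡-Reasoning
  n*[d+1]*1≡n*[d*1+1] : (n ℤ.* + suc d) ℤ.* + 1 ≡ n ℤ.* + suc (d ℕ.* 1)
  n*[d+1]*1≡n*[d*1+1] = trans (ℤP.*-identityʳ _) (cong (λ t → n ℤ.* + suc t) (sym (ℕP.*-identityʳ d)))

ClearedBy-*ʳ : ∀ {k x} m → ClearedBy k x → ClearedBy (k ℕ.* m) x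
ClearedBy-*ʳ {k} {x} m (cleared i) = cleared (subst Integral (begin
    x ℚ.* fromℕ k ℚ.* fromℕ m    ≡⟨ ℚP.*-assoc x (fromℕ k) (fromℕ m) ⟩
    x ℚ.* (fromℕ k ℚ.* fromℕ m)  ≡⟨ cong (x ℚ.*_) (fromℕ-* k m) ⟩
    x ℚ.* fromℕ (k ℕ.* m)        ∎)
  (Integral-* i (+ m , refl)))
  where open ≡-Reasoning

ClearedBy-*ˡ : ∀ {k x} m → ClearedBy k x → ClearedBy (m ℕ.* k) x
ClearedBy-*ˡ {k} {x} m c = subst (λ n → ClearedBy n x) (ℕP.*-comm k m) (ClearedBy-*ʳ m c)

ClearedBy-+ : ∀ {k x y} → ClearedBy k x → ClearedBy k y → ClearedBy k (x ℚ.+ y)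
ClearedBy-+ {k} {x} {y} (cleared ix) (cleared iy) =
  cleared (subst Integral (sym (ℚP.*-distribʳ-+ (fromℕ k) x y)) (Integral-+ ix iy))

ClearedBy-minus : ∀ {k x y} → ClearedBy k x → ClearedBy k y → ClearedBy k (x ℚ.- y)
ClearedBy-minus {k} {x} {y} (cleared ix) (cleared iy) =
  cleared (subst Integral (sym (distrib x y (fromℕ k))) (Integral-minus ix iy))
  where
  distrib : ∀ x y z → (x ℚ.- y) ℚ.* z ≡ x ℚ.* z ℚ.- y ℚ.* z
  distrib = solve-∀ ℚ-acr

ClearedBy-pos⇒≥1 : ∀ {k x} → 0 ℕ.< k → ClearedBy k x → 0ℚ ℚ.< x → 1ℚ ℚ.≤ x ℚ.* fromℕ k
ClearedBy-pos⇒≥1 k>0 (cleared i) x>0 = Integral-pos⇒≥1 i (pos*pos x>0 (fromℕ-pos k>0))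

-- The polynomial ring ℚ[X]

coeff-+ : ∀ p q n → coeff (p +ₚ q) n ≡ coeff p n ℚ.+ coeff q n
coeff-+ []      q       n       = sym (ℚP.+-identityˡ _)
coeff-+ (a ∷ p) []      zero    = sym (ℚP.+-identityʳ _)
coeff-+ (a ∷ p) []      (suc n) = sym (ℚP.+-identityʳ _)
coeff-+ (a ∷ p) (b ∷ q) zero    = refl
coeff-+ (a ∷ p) (b ∷ q) (suc n) = coeff-+ p q n

coeff-· : ∀ c p n → coeff (c ·ₚ p) n ≡ c ℚ.* coeff p n
coeff-· c []      n       = sym (ℚP.*-zeroʳ c)
coeff-· c (a ∷ p) zero    = refl
coeff-· c (a ∷ p) (suc n) = coeff-· c p n

coeff-neg : ∀ p n → coeff (-ₚ p) n ≡ ℚ.- coeff p n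
coeff-neg p n = trans (coeff-· (ℚ.- 1ℚ) p n) (-1*x≡-x (coeff p n))

coeff-minus : ∀ p q n → coeff (p -ₚ q) n ≡ coeff p n ℚ.- coeff q n
coeff-minus p q n = trans (coeff-+ p (-ₚ q) n) (cong (coeff p n ℚ.+_) (coeff-neg q n))

coeff-*-0 : ∀ p q → coeff (p *ₚ q) 0 ≡ coeff p 0 ℚ.* coeff q 0
coeff-*-0 []      q = sym (ℚP.*-zeroˡ (coeff q 0))
coeff-*-0 (a ∷ p) q = trans (coeff-+ (a ·ₚ q) (0ℚ ∷ p *ₚ q) 0)
                            (trans (ℚP.+-identityʳ _) (coeff-· a q 0))

-- _≈ₚ_ wrapped in a record, so that both polynomials can be inferred from a proof.
infix 4 _≋_
record _≋_ (p q : Poly) : Set where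
  constructor mk≋
  field coeff-≡ : p ≈ₚ q
open _≋_ public

≋-refl : ∀ {p} → p ≋ p
≋-refl = mk≋ λ _ → refl

≋-sym : ∀ {p q} → p ≋ q → q ≋ p
≋-sym (mk≋ e) = mk≋ λ n → sym (e n)

≋-trans : ∀ {p q r} → p ≋ q → q ≋ r → p ≋ r
≋-trans (mk≋ e) (mk≋ f) = mk≋ λ n → trans (e n) (f n)

∷-cong : ∀ {a b p q} → a ≡ b → p ≋ q → a ∷ p ≋ b ∷ q
∷-cong a≡b (mk≋ e) = mk≋ λ { zero → a≡b ; (suc n) → e n }

0ₚ≋0∷0ₚ : 0ₚ ≋ 0ℚ ∷ 0ₚ
0ₚ≋0∷0ₚ = mk≋ λ { zero → refl ; (suc n) → refl }

0∷-+ : ∀ p q → 0ℚ ∷ (p +ₚ q) ≋ (0ℚ ∷ p) +ₚ (0ℚ ∷ q)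
0∷-+ p q = ∷-cong (sym (ℚP.+-identityˡ 0ℚ)) ≋-refl

+-cong : ∀ {p p′ q q′} → p ≋ p′ → q ≋ q′ → p +ₚ q ≋ p′ +ₚ q′
+-cong {p} {p′} {q} {q′} (mk≋ e) (mk≋ f) = mk≋ λ n → begin
  coeff (p +ₚ q) n           ≡⟨ coeff-+ p q n ⟩
  coeff p n ℚ.+ coeff q n     ≡⟨ cong₂ ℚ._+_ (e n) (f n) ⟩
  coeff p′ n ℚ.+ coeff q′ n   ≡⟨ coeff-+ p′ q′ n ⟨
  coeff (p′ +ₚ q′) n         ∎
  where open ≡-Reasoning

+-assoc : ∀ p q r → (p +ₚ q) +ₚ r ≋ p +ₚ (q +ₚ r)
+-assoc []      q       r       = ≋-refl
+-assoc (a ∷ p) []      r       = ≋-refl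
+-assoc (a ∷ p) (b ∷ q) []      = ≋-refl
+-assoc (a ∷ p) (b ∷ q) (c ∷ r) = ∷-cong (ℚP.+-assoc a b c) (+-assoc p q r)

+-comm : ∀ p q → p +ₚ q ≋ q +ₚ p
+-comm []      []      = ≋-refl
+-comm []      (b ∷ q) = ≋-refl
+-comm (a ∷ p) []      = ≋-refl
+-comm (a ∷ p) (b ∷ q) = ∷-cong (ℚP.+-comm a b) (+-comm p q)

+-identityʳ : ∀ p → p +ₚ 0ₚ ≋ p
+-identityʳ []      = ≋-refl
+-identityʳ (a ∷ p) = ≋-refl

+-inverseʳ : ∀ p → p +ₚ -ₚ p ≋ 0ₚ
+-inverseʳ []      = ≋-refl
+-inverseʳ (a ∷ p) = ≋-trans (∷-cong a-a≡0 (+-inverseʳ p)) (≋-sym 0ₚ≋0∷0ₚ)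
  where
  a-a≡0 : a ℚ.+ ℚ.- 1ℚ ℚ.* a ≡ 0ℚ
  a-a≡0 = trans (cong (a ℚ.+_) (-1*x≡-x a)) (ℚP.+-inverseʳ a)

+-commutativeSemigroup : CommutativeSemigroup _ _
+-commutativeSemigroup = record
  { Carrier = Poly ; _≈_ = _≋_ ; _∙_ = _+ₚ_
  ; isCommutativeSemigroup = record
    { isSemigroup = record
      { isMagma = record
        { isEquivalence = record { refl = ≋-refl ; sym = ≋-sym ; trans = ≋-trans }
        ; ∙-cong = +-cong }
      ; assoc = +-assoc }
    ; comm = +-comm } }

open CommSemigroupProperties +-commutativeSemigroup using (interchange; x∙yz≈y∙xz)

·-congʳ : ∀ c {p q} → p ≋ q → c ·ₚ p ≋ c ·ₚ q
·-congʳ c {p} {q} (mk≋ e) = mk≋ λ n →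
  trans (coeff-· c p n) (trans (cong (c ℚ.*_) (e n)) (sym (coeff-· c q n)))

·-distribˡ-+ : ∀ c p q → c ·ₚ (p +ₚ q) ≋ c ·ₚ p +ₚ c ·ₚ q
·-distribˡ-+ c []      q       = ≋-refl
·-distribˡ-+ c (a ∷ p) []      = ≋-refl
·-distribˡ-+ c (a ∷ p) (b ∷ q) = ∷-cong (ℚP.*-distribˡ-+ c a b) (·-distribˡ-+ c p q)

·-distribʳ-+ : ∀ c d p → (c ℚ.+ d) ·ₚ p ≋ c ·ₚ p +ₚ d ·ₚ p
·-distribʳ-+ c d []      = ≋-refl
·-distribʳ-+ c d (a ∷ p) = ∷-cong (ℚP.*-distribʳ-+ a c d) (·-distribʳ-+ c d p)

·-assoc : ∀ c d p → c ·ₚ (d ·ₚ p) ≋ (c ℚ.* d) ·ₚ p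
·-assoc c d []      = ≋-refl
·-assoc c d (a ∷ p) = ∷-cong (sym (ℚP.*-assoc c d a)) (·-assoc c d p)

·-identity : ∀ p → 1ℚ ·ₚ p ≋ p
·-identity []      = ≋-refl
·-identity (a ∷ p) = ∷-cong (ℚP.*-identityˡ a) (·-identity p)

0·p≋0 : ∀ p → 0ℚ ·ₚ p ≋ 0ₚ
0·p≋0 []      = ≋-refl
0·p≋0 (a ∷ p) = ≋-trans (∷-cong (ℚP.*-zeroˡ a) (0·p≋0 p)) (≋-sym 0ₚ≋0∷0ₚ)

*-zeroʳ : ∀ p → p *ₚ 0ₚ ≋ 0ₚ
*-zeroʳ []      = ≋-refl
*-zeroʳ (a ∷ p) = ≋-trans (∷-cong refl (*-zeroʳ p)) (≋-sym 0ₚ≋0∷0ₚ)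

*-congʳ : ∀ p {q q′} → q ≋ q′ → p *ₚ q ≋ p *ₚ q′
*-congʳ []      e = ≋-refl
*-congʳ (a ∷ p) e = +-cong (·-congʳ a e) (∷-cong refl (*-congʳ p e))

*-∷ʳ : ∀ p b q → p *ₚ (b ∷ q) ≋ b ·ₚ p +ₚ (0ℚ ∷ p *ₚ q)
*-∷ʳ []      b q = 0ₚ≋0∷0ₚ
*-∷ʳ (a ∷ p) b q = ∷-cong (cong (ℚ._+ 0ℚ) (ℚP.*-comm a b))
  (≋-trans (+-cong ≋-refl (*-∷ʳ p b q)) (x∙yz≈y∙xz (a ·ₚ q) (b ·ₚ p) (0ℚ ∷ p *ₚ q)))

*-comm : ∀ p q → p *ₚ q ≋ q *ₚ p
*-comm []      q = ≋-sym (*-zeroʳ q)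
*-comm (a ∷ p) q = ≋-trans (+-cong ≋-refl (∷-cong refl (*-comm p q))) (≋-sym (*-∷ʳ q a p))

*-congˡ : ∀ {p p′} q → p ≋ p′ → p *ₚ q ≋ p′ *ₚ q
*-congˡ {p} {p′} q e = ≋-trans (*-comm p q) (≋-trans (*-congʳ q e) (*-comm q p′))

*-cong : ∀ {p p′ q q′} → p ≋ p′ → q ≋ q′ → p *ₚ q ≋ p′ *ₚ q′
*-cong {p′ = p′} {q = q} e f = ≋-trans (*-congˡ q e) (*-congʳ p′ f)

*-distribʳ-+ : ∀ r p q → (p +ₚ q) *ₚ r ≋ p *ₚ r +ₚ q *ₚ r
*-distribʳ-+ r []      q       = ≋-refl
*-distribʳ-+ r (a ∷ p) []      = ≋-sym (+-identityʳ _)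
*-distribʳ-+ r (a ∷ p) (b ∷ q) = ≋-trans
  (+-cong (·-distribʳ-+ a b r) (≋-trans (∷-cong refl (*-distribʳ-+ r p q)) (0∷-+ (p *ₚ r) (q *ₚ r))))
  (interchange (a ·ₚ r) (b ·ₚ r) (0ℚ ∷ p *ₚ r) (0ℚ ∷ q *ₚ r))

*-distribˡ-+ : ∀ r p q → r *ₚ (p +ₚ q) ≋ r *ₚ p +ₚ r *ₚ q
*-distribˡ-+ r p q = ≋-trans (*-comm r (p +ₚ q))
  (≋-trans (*-distribʳ-+ r p q) (+-cong (*-comm p r) (*-comm q r)))

·-*-assoc : ∀ c p q → (c ·ₚ p) *ₚ q ≋ c ·ₚ (p *ₚ q)
·-*-assoc c []      q = ≋-refl
·-*-assoc c (a ∷ p) q = ≋-trans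
  (+-cong (≋-sym (·-assoc c a q)) (∷-cong (sym (ℚP.*-zeroʳ c)) (·-*-assoc c p q)))
  (≋-sym (·-distribˡ-+ c (a ·ₚ q) (0ℚ ∷ p *ₚ q)))

*-assoc : ∀ p q r → (p *ₚ q) *ₚ r ≋ p *ₚ (q *ₚ r)
*-assoc []      q r = ≋-refl
*-assoc (a ∷ p) q r = ≋-trans (*-distribʳ-+ r (a ·ₚ q) (0ℚ ∷ p *ₚ q))
  (+-cong (·-*-assoc a q r) (+-cong (0·p≋0 r) (∷-cong refl (*-assoc p q r))))

*-identityˡ : ∀ p → 1ₚ *ₚ p ≋ p
*-identityˡ p = ≋-trans (+-cong (·-identity p) (≋-sym 0ₚ≋0∷0ₚ)) (+-identityʳ p)

ℚ[X] : CommutativeRing _ _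
ℚ[X] = record
  { Carrier = Poly ; _≈_ = _≋_ ; _+_ = _+ₚ_ ; _*_ = _*ₚ_ ; -_ = -ₚ_ ; 0# = 0ₚ ; 1# = 1ₚ
  ; isCommutativeRing = record
    { isRing = record
      { +-isAbelianGroup = record
        { isGroup = record
          { isMonoid = record
            { isSemigroup = CommutativeSemigroup.isSemigroup +-commutativeSemigroup
            ; identity = (λ _ → ≋-refl) , +-identityʳ }
          ; inverse = (λ p → ≋-trans (+-comm (-ₚ p) p) (+-inverseʳ p)) , +-inverseʳ
          ; ⁻¹-cong = ·-congʳ (ℚ.- 1ℚ) }
        ; comm = +-comm }
      ; *-cong = *-cong
      ; *-assoc = *-assoc
      ; *-identity = *-identityˡ , (λ p → ≋-trans (*-comm p 1ₚ) (*-identityˡ p))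
      ; distrib = *-distribˡ-+ , *-distribʳ-+ }
    ; *-comm = *-comm } }

0ₚ≟_ : ∀ p → Maybe (0ₚ ≋ p)
0ₚ≟ []      = just ≋-refl
0ₚ≟ (a ∷ p) with 0ℚ ℚP.≟ a | 0ₚ≟ p
... | yes 0≡a | just 0≋p = just (≋-trans 0ₚ≋0∷0ₚ (∷-cong 0≡a 0≋p))
... | _       | _        = nothing

ℚ[X]-acr : AlmostCommutativeRing _ _
ℚ[X]-acr = fromCommutativeRing ℚ[X] 0ₚ≟_

record Deg≤ (n : ℕ) (p : Poly) : Set where
  constructor mkDeg≤
  field vanish : ∀ {m} → n ℕ.< m → coeff p m ≡ 0ℚ
open Deg≤ public

record TopTerm (n : ℕ) (x : ℚ) (p : Poly) : Set where
  constructor mkTopTerm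
  field
    deg≤     : Deg≤ n p
    coeff-top : coeff p n ≡ x
open TopTerm public

Deg≤-resp : ∀ {n p q} → p ≋ q → Deg≤ n p → Deg≤ n q
Deg≤-resp (mk≋ e) (mkDeg≤ v) = mkDeg≤ λ {m} n<m → trans (sym (e m)) (v n<m)

Deg≤-mono : ∀ {m n p} → m ℕ.≤ n → Deg≤ m p → Deg≤ n p
Deg≤-mono m≤n (mkDeg≤ v) = mkDeg≤ λ n<k → v (ℕP.≤-<-trans m≤n n<k)

Deg≤-0ₚ : ∀ {n} → Deg≤ n 0ₚ
Deg≤-0ₚ = mkDeg≤ λ _ → refl

Deg≤-+ : ∀ {n p q} → Deg≤ n p → Deg≤ n q → Deg≤ n (p +ₚ q)
Deg≤-+ {p = p} {q} (mkDeg≤ u) (mkDeg≤ v) = mkDeg≤ λ {m} n<m →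
  trans (coeff-+ p q m) (trans (cong₂ ℚ._+_ (u n<m) (v n<m)) (ℚP.+-identityˡ 0ℚ))

Deg≤-· : ∀ {n p} c → Deg≤ n p → Deg≤ n (c ·ₚ p)
Deg≤-· {p = p} c (mkDeg≤ v) = mkDeg≤ λ {m} n<m →
  trans (coeff-· c p m) (trans (cong (c ℚ.*_) (v n<m)) (ℚP.*-zeroʳ c))

Deg≤-minus : ∀ {n p q} → Deg≤ n p → Deg≤ n q → Deg≤ n (p -ₚ q)
Deg≤-minus dp dq = Deg≤-+ dp (Deg≤-· (ℚ.- 1ℚ) dq)

Deg≤-∷ : ∀ {n a p} → Deg≤ n p → Deg≤ (suc n) (a ∷ p)
Deg≤-∷ (mkDeg≤ v) = mkDeg≤ λ { {suc m} (ℕ.s≤s n<m) → v n<m }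

Deg≤-tail : ∀ {n a p} → Deg≤ (suc n) (a ∷ p) → Deg≤ n p
Deg≤-tail (mkDeg≤ v) = mkDeg≤ λ n<m → v (ℕ.s≤s n<m)

Deg≤0-tail : ∀ {a p} → Deg≤ 0 (a ∷ p) → p ≋ 0ₚ
Deg≤0-tail (mkDeg≤ v) = mk≋ λ m → v (ℕ.s≤s ℕ.z≤n)

Deg≤-pred : ∀ {n p} → Deg≤ (suc n) p → coeff p (suc n) ≡ 0ℚ → Deg≤ n p
Deg≤-pred (mkDeg≤ v) top≡0 = mkDeg≤ λ n<m → [ v , (λ { refl → top≡0 }) ]′ (ℕP.m≤n⇒m<n∨m≡n n<m)

coeff≢0⇒≤ : ∀ {n m p} → Deg≤ n p → coeff p m ≢ 0ℚ → m ℕ.≤ n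
coeff≢0⇒≤ (mkDeg≤ v) p[m]≢0 = ℕP.≮⇒≥ λ n<m → p[m]≢0 (v n<m)

Deg≤0⇒≋0 : ∀ {p} → Deg≤ 0 p → coeff p 0 ≡ 0ℚ → p ≋ 0ₚ
Deg≤0⇒≋0 (mkDeg≤ v) p[0]≡0 = mk≋ λ { zero → p[0]≡0 ; (suc m) → v (ℕ.s≤s ℕ.z≤n) }

TopTerm-resp : ∀ {n x p q} → p ≋ q → TopTerm n x p → TopTerm n x q
TopTerm-resp p≋q (mkTopTerm d t) = mkTopTerm (Deg≤-resp p≋q d) (trans (sym (coeff-≡ p≋q _)) t)

TopTerm-const : ∀ {a p} → p ≋ 0ₚ → TopTerm 0 a (a ∷ p)
TopTerm-const (mk≋ e) = mkTopTerm (mkDeg≤ λ { {suc m} _ → e m }) refl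

TopTerm-∷ : ∀ {n x a p} → TopTerm n x p → TopTerm (suc n) x (a ∷ p)
TopTerm-∷ (mkTopTerm d t) = mkTopTerm (Deg≤-∷ d) t

TopTerm-1ₚ : TopTerm 0 1ℚ 1ₚ
TopTerm-1ₚ = TopTerm-const ≋-refl

TopTerm-· : ∀ {n x p} c → TopTerm n x p → TopTerm n (c ℚ.* x) (c ·ₚ p)
TopTerm-· {n} {p = p} c (mkTopTerm d t) = mkTopTerm (Deg≤-· c d) (trans (coeff-· c p n) (cong (c ℚ.*_) t))

TopTerm-+ : ∀ {n x y p q} → TopTerm n x p → TopTerm n y q → TopTerm n (x ℚ.+ y) (p +ₚ q)
TopTerm-+ {n} {p = p} {q} (mkTopTerm dp tp) (mkTopTerm dq tq) =
  mkTopTerm (Deg≤-+ dp dq) (trans (coeff-+ p q n) (cong₂ ℚ._+_ tp tq))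

TopTerm-+ˡ : ∀ {m n x p q} → m ℕ.< n → Deg≤ m q → TopTerm n x p → TopTerm n x (q +ₚ p)
TopTerm-+ˡ {n = n} {x} {p} {q} m<n dq tp = subst (λ y → TopTerm n y (q +ₚ p)) (ℚP.+-identityˡ x)
  (TopTerm-+ (mkTopTerm (Deg≤-mono (ℕP.<⇒≤ m<n) dq) (vanish dq m<n)) tp)

TopTerm-tail : ∀ {n x a p} → TopTerm (suc n) x (a ∷ p) → TopTerm n x p
TopTerm-tail (mkTopTerm d t) = mkTopTerm (Deg≤-tail d) t

TopTerm-* : ∀ {i j x y p q} → TopTerm i x p → TopTerm j y q → TopTerm (i ℕ.+ j) (x ℚ.* y) (p *ₚ q)
TopTerm-* {x = x} {y} {[]} (mkTopTerm _ 0≡x) _ =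
  mkTopTerm Deg≤-0ₚ (sym (trans (cong (ℚ._* y) (sym 0≡x)) (ℚP.*-zeroˡ y)))
TopTerm-* {zero} {x = x} {y} {a ∷ p} {q} tp tq =
  subst (λ z → TopTerm _ (z ℚ.* y) _) (coeff-top tp) (TopTerm-resp (≋-sym ap*q≋a·q) (TopTerm-· a tq))
  where
  ap*q≋a·q : (a ∷ p) *ₚ q ≋ a ·ₚ q
  ap*q≋a·q = ≋-trans (+-cong ≋-refl (≋-trans (∷-cong refl (*-congˡ q (Deg≤0-tail (deg≤ tp))))
                                            (≋-sym 0ₚ≋0∷0ₚ)))
                     (+-identityʳ (a ·ₚ q))
TopTerm-* {suc i} {j} {p = a ∷ p} {q} tp tq =
  TopTerm-+ˡ (ℕ.s≤s (ℕP.m≤n+m j i)) (Deg≤-· a (deg≤ tq)) (TopTerm-∷ (TopTerm-* (TopTerm-tail tp) tq))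

TopTerm-unique : ∀ {i j x y p} → TopTerm i x p → TopTerm j y p → x ≢ 0ℚ → y ≢ 0ℚ → i ≡ j × x ≡ y
TopTerm-unique {i} {j} {x} {y} {p} (mkTopTerm di ti) (mkTopTerm dj tj) x≢0 y≢0 = i≡j , x≡y
  where
  i≡j : i ≡ j
  i≡j = ℕP.≤-antisym (coeff≢0⇒≤ dj (λ z → x≢0 (trans (sym ti) z)))
                     (coeff≢0⇒≤ di (λ z → y≢0 (trans (sym tj) z)))
  x≡y : x ≡ y
  x≡y = trans (sym ti) (trans (cong (coeff p) i≡j) tj)

monomial : ℚ → ℕ → Poly
monomial x zero    = x ∷ []
monomial x (suc n) = 0ℚ ∷ monomial x n

TopTerm-monomial : ∀ x n → TopTerm n x (monomial x n)
TopTerm-monomial x zero    = TopTerm-const ≋-refl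
TopTerm-monomial x (suc n) = TopTerm-∷ (TopTerm-monomial x n)

IntConst-monomial-suc : ∀ x n → IntConst (monomial x (suc n))
IntConst-monomial-suc x n = + 0 , refl

IntConst-monomial : ∀ {x} n → Integral x → IntConst (monomial x n)
IntConst-monomial zero    ix = ix
IntConst-monomial {x} (suc n) _ = IntConst-monomial-suc x n

Deg≤-length : ∀ p → Deg≤ (length p) p
Deg≤-length []      = Deg≤-0ₚ
Deg≤-length (a ∷ p) = Deg≤-∷ (Deg≤-length p)

Deg≤-cancel : ∀ {n x p q} → TopTerm (suc n) x p → TopTerm (suc n) x q → Deg≤ n (p -ₚ q)
Deg≤-cancel {n} {x} {p} {q} tp tq = Deg≤-pred (Deg≤-minus (deg≤ tp) (deg≤ tq))
  (trans (coeff-minus p q (suc n)) (trans (cong₂ ℚ._-_ (coeff-top tp) (coeff-top tq)) (ℚP.+-inverseʳ x)))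

TopTerm-agree : ∀ {i j x y p q} → Deg≤ 0 (p -ₚ q) → TopTerm i x p → TopTerm j y q →
                x ≢ 0ℚ → y ≢ 0ℚ → 0 ℕ.< i ⊎ 0 ℕ.< j → i ≡ j × x ≡ y
TopTerm-agree {p = p} {q} d tp tq x≢0 y≢0 (inj₁ i>0) =
  TopTerm-unique (TopTerm-resp (cancel p q) (TopTerm-+ˡ i>0 (Deg≤-· (ℚ.- 1ℚ) d) tp)) tq x≢0 y≢0
  where
  cancel : ∀ p q → -ₚ (p -ₚ q) +ₚ p ≋ q
  cancel = solve-∀ ℚ[X]-acr
TopTerm-agree {p = p} {q} d tp tq x≢0 y≢0 (inj₂ j>0) =
  TopTerm-unique tp (TopTerm-resp (cancel p q) (TopTerm-+ˡ j>0 d tq)) x≢0 y≢0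
  where
  cancel : ∀ p q → (p -ₚ q) +ₚ q ≋ p
  cancel = solve-∀ ℚ[X]-acr

equal-gaps : ∀ {α β γ δ} → γ ℕ.< α → α ℕ.+ δ ≡ β ℕ.+ γ →
             ∃ λ e → α ≡ suc e ℕ.+ γ × β ≡ suc e ℕ.+ δ
equal-gaps {α} {β} {γ} {δ} γ<α α+δ≡β+γ = α ℕ.∸ suc γ , α≡ , ℕP.+-cancelʳ-≡ γ β _ (begin
    β ℕ.+ γ                        ≡⟨ α+δ≡β+γ ⟨
    α ℕ.+ δ                        ≡⟨ cong (ℕ._+ δ) α≡ ⟩
    suc (α ℕ.∸ suc γ) ℕ.+ γ ℕ.+ δ  ≡⟨ ℕ-xy∙z≈xz∙y (suc (α ℕ.∸ suc γ)) γ δ ⟩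
    suc (α ℕ.∸ suc γ) ℕ.+ δ ℕ.+ γ  ∎)
  where
  open ≡-Reasoning
  open CommSemigroupProperties ℕP.+-commutativeSemigroup renaming (xy∙z≈xz∙y to ℕ-xy∙z≈xz∙y)
  α≡ : α ≡ suc (α ℕ.∸ suc γ) ℕ.+ γ
  α≡ = sym (trans (sym (ℕP.+-suc (α ℕ.∸ suc γ) γ)) (ℕP.m∸n+n≡m γ<α))

-- The order of ℚ[X]

record Positive (p : Poly) : Set where
  constructor mkPositive
  field
    {degree} : ℕ
    {lead}   : ℚ
    lead>0   : 0ℚ ℚ.< lead
    top      : TopTerm degree lead p
open Positive public

NonNegative : Poly → Set
NonNegative p = p ≋ 0ₚ ⊎ Positive p

infix 4 _≤ₚ_
_≤ₚ_ : Poly → Poly → Set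
p ≤ₚ q = NonNegative (q -ₚ p)

Positive-resp : ∀ {p q} → p ≋ q → Positive p → Positive q
Positive-resp p≋q (mkPositive x>0 t) = mkPositive x>0 (TopTerm-resp p≋q t)

NonNegative-resp : ∀ {p q} → p ≋ q → NonNegative p → NonNegative q
NonNegative-resp p≋q (inj₁ p≋0) = inj₁ (≋-trans (≋-sym p≋q) p≋0)
NonNegative-resp p≋q (inj₂ p>0) = inj₂ (Positive-resp p≋q p>0)

Positive⇒≉0 : ∀ {p} → Positive p → ¬ p ≋ 0ₚ
Positive⇒≉0 (mkPositive x>0 (mkTopTerm _ t)) (mk≋ e) = >0⇒≢0 x>0 (trans (sym t) (e _))

Positive-1ₚ : Positive 1ₚ
Positive-1ₚ = mkPositive (ℚP.positive⁻¹ 1ℚ) TopTerm-1ₚ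

Positive-+ : ∀ {p q} → Positive p → NonNegative q → Positive (p +ₚ q)
Positive-+ {p} {q} p>0 (inj₁ q≋0) =
  Positive-resp (≋-trans (≋-sym (+-identityʳ p)) (+-cong ≋-refl (≋-sym q≋0))) p>0
Positive-+ {p} {q} (mkPositive {i} x>0 tp) (inj₂ (mkPositive {j} y>0 tq)) with ℕP.<-cmp i j
... | tri< i<j _ _ = mkPositive y>0 (TopTerm-+ˡ i<j (deg≤ tp) tq)
... | tri≈ _ refl _ = mkPositive (pos+pos x>0 y>0) (TopTerm-+ tp tq)
... | tri> _ _ j<i = mkPositive x>0 (TopTerm-resp (+-comm q p) (TopTerm-+ˡ j<i (deg≤ tq) tp))

NonNegative-+ : ∀ {p q} → NonNegative p → NonNegative q → NonNegative (p +ₚ q)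
NonNegative-+ (inj₁ p≋0) q≥0 = NonNegative-resp (+-cong (≋-sym p≋0) ≋-refl) q≥0
NonNegative-+ (inj₂ p>0) q≥0 = inj₂ (Positive-+ p>0 q≥0)

Positive-* : ∀ {p q} → Positive p → Positive q → Positive (p *ₚ q)
Positive-* (mkPositive x>0 tp) (mkPositive y>0 tq) = mkPositive (pos*pos x>0 y>0) (TopTerm-* tp tq)

NonNegative-* : ∀ {p q} → NonNegative p → NonNegative q → NonNegative (p *ₚ q)
NonNegative-* {p} {q} (inj₁ p≋0) _          = inj₁ (*-congˡ q p≋0)
NonNegative-* {p} {q} (inj₂ _)   (inj₁ q≋0) = inj₁ (≋-trans (*-congʳ p q≋0) (*-zeroʳ p))
NonNegative-* {p} {q} (inj₂ p>0) (inj₂ q>0) = inj₂ (Positive-* p>0 q>0)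

neg-involutive : ∀ p → -ₚ (-ₚ p) ≋ p
neg-involutive = solve-∀ ℚ[X]-acr

TopTerm-neg : ∀ {n x p} → TopTerm n x (-ₚ p) → TopTerm n (ℚ.- x) p
TopTerm-neg {n} {x} {p} t =
  subst (λ y → TopTerm n y p) (-1*x≡-x x) (TopTerm-resp (neg-involutive p) (TopTerm-· (ℚ.- 1ℚ) t))

¬Positive-both : ∀ {p} → Positive p → Positive (-ₚ p) → ⊥
¬Positive-both (mkPositive {lead = x} x>0 tp) (mkPositive {lead = y} y>0 t-p) =
  ℚP.<-asym x>0 (subst (ℚ._< 0ℚ) (sym x≡-y) (ℚP.neg-antimono-< y>0))
  where
  x≡-y : x ≡ ℚ.- y
  x≡-y = proj₂ (TopTerm-unique tp (TopTerm-neg t-p) (>0⇒≢0 x>0)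
                               (λ -y≡0 → >0⇒≢0 y>0 (ℚP.neg-injective -y≡0)))

NonNegative-antisym : ∀ {p} → NonNegative p → NonNegative (-ₚ p) → p ≋ 0ₚ
NonNegative-antisym (inj₁ p≋0) _ = p≋0
NonNegative-antisym {p} (inj₂ p>0) (inj₁ -p≋0) =
  ⊥-elim (Positive⇒≉0 p>0 (≋-trans (≋-sym (neg-involutive p)) (·-congʳ (ℚ.- 1ℚ) -p≋0)))
NonNegative-antisym (inj₂ p>0) (inj₂ -p>0) = ⊥-elim (¬Positive-both p>0 -p>0)

trichotomy : ∀ p → p ≋ 0ₚ ⊎ Positive p ⊎ Positive (-ₚ p)
trichotomy [] = inj₁ ≋-refl
trichotomy (a ∷ p) with trichotomy p
... | inj₂ (inj₁ (mkPositive x>0 t)) = inj₂ (inj₁ (mkPositive x>0 (TopTerm-∷ t)))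
... | inj₂ (inj₂ (mkPositive x>0 t)) = inj₂ (inj₂ (mkPositive x>0 (TopTerm-∷ t)))
... | inj₁ p≋0 with ℚP.<-cmp 0ℚ a
...   | tri< a>0 _ _ = inj₂ (inj₁ (mkPositive a>0 (TopTerm-const p≋0)))
...   | tri≈ _ refl _ = inj₁ (≋-trans (∷-cong refl p≋0) (≋-sym 0ₚ≋0∷0ₚ))
...   | tri> _ _ a<0 = inj₂ (inj₂ (mkPositive -a>0 (TopTerm-const (·-congʳ (ℚ.- 1ℚ) p≋0))))
  where
  -a>0 : 0ℚ ℚ.< ℚ.- 1ℚ ℚ.* a
  -a>0 = subst (0ℚ ℚ.<_) (sym (-1*x≡-x a)) (ℚP.neg-antimono-< a<0)

neg-minus : ∀ p q → -ₚ (p -ₚ q) ≋ q -ₚ p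
neg-minus = solve-∀ ℚ[X]-acr

minus≋0⇒≋ : ∀ {p q} → p -ₚ q ≋ 0ₚ → p ≋ q
minus≋0⇒≋ {p} {q} p-q≋0 = ≋-trans (x≋y+[x-y] p q) (≋-trans (+-cong ≋-refl p-q≋0) (+-identityʳ q))
  where
  x≋y+[x-y] : ∀ x y → x ≋ y +ₚ (x -ₚ y)
  x≋y+[x-y] = solve-∀ ℚ[X]-acr

≤ₚ-antisym : ∀ {p q} → p ≤ₚ q → q ≤ₚ p → p ≋ q
≤ₚ-antisym {p} {q} p≤q q≤p =
  ≋-sym (minus≋0⇒≋ (NonNegative-antisym p≤q (NonNegative-resp (≋-sym (neg-minus q p)) q≤p)))

infix 4 _<ₚ_
_<ₚ_ : Poly → Poly → Set
p <ₚ q = Positive (q -ₚ p)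

≤ₚ-total : ∀ p q → p ≤ₚ q ⊎ q <ₚ p
≤ₚ-total p q with trichotomy (q -ₚ p)
... | inj₁ q-p≋0         = inj₁ (inj₁ q-p≋0)
... | inj₂ (inj₁ q-p>0)  = inj₁ (inj₂ q-p>0)
... | inj₂ (inj₂ -[q-p]>0) = inj₂ (Positive-resp (neg-minus q p) -[q-p]>0)

¬1≤ₚ0 : ¬ 1ₚ ≤ₚ 0ₚ
¬1≤ₚ0 1≤0 = Positive⇒≉0 Positive-1ₚ (≤ₚ-antisym 1≤0 (inj₂ Positive-1ₚ))

NonNegative-+-zero : ∀ {p q} → NonNegative p → NonNegative q → p +ₚ q ≋ 0ₚ → p ≋ 0ₚ × q ≋ 0ₚ
NonNegative-+-zero {p} {q} p≥0 q≥0 p+q≋0 = ≋-trans p≋-q (·-congʳ (ℚ.- 1ℚ) q≋0) , q≋0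
  where
  x≋[x+y]-y : ∀ x y → x ≋ (x +ₚ y) -ₚ y
  x≋[x+y]-y = solve-∀ ℚ[X]-acr
  p≋-q : p ≋ -ₚ q
  p≋-q = ≋-trans (x≋[x+y]-y p q) (+-cong p+q≋0 ≋-refl)
  q≋0 : q ≋ 0ₚ
  q≋0 = NonNegative-antisym q≥0 (NonNegative-resp p≋-q p≥0)

NonNegative-*-zero : ∀ {p q} → NonNegative p → Positive q → p *ₚ q ≋ 0ₚ → p ≋ 0ₚ
NonNegative-*-zero (inj₁ p≋0)  _   _     = p≋0
NonNegative-*-zero (inj₂ p>0) q>0 pq≋0 = ⊥-elim (Positive⇒≉0 (Positive-* p>0 q>0) pq≋0)

Positive-cancelʳ : ∀ {p q} → Positive q → Positive (p *ₚ q) → Positive p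
Positive-cancelʳ {p} {q} q>0 pq>0 with trichotomy p
... | inj₁ p≋0          = ⊥-elim (Positive⇒≉0 pq>0 (*-congˡ q p≋0))
... | inj₂ (inj₁ p>0)  = p>0
... | inj₂ (inj₂ -p>0) = ⊥-elim (¬Positive-both pq>0 (Positive-resp (neg-*ˡ p q) (Positive-* -p>0 q>0)))
  where
  neg-*ˡ : ∀ p q → (-ₚ p) *ₚ q ≋ -ₚ (p *ₚ q)
  neg-*ˡ = solve-∀ ℚ[X]-acr

NonNegative⇒¬Positive-neg : ∀ {p} → NonNegative p → ¬ Positive (-ₚ p)
NonNegative⇒¬Positive-neg {p} p≥0 -p>0 =
  Positive⇒≉0 -p>0 (·-congʳ (ℚ.- 1ℚ) (NonNegative-antisym p≥0 (inj₂ -p>0)))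

Positive-mono-≤ₚ : ∀ {p q} → Positive p → p ≤ₚ q → Positive q
Positive-mono-≤ₚ {p} {q} p>0 p≤q = Positive-resp (y+[x-y]≋x q p) (Positive-+ p>0 p≤q)
  where
  y+[x-y]≋x : ∀ x y → y +ₚ (x -ₚ y) ≋ x
  y+[x-y]≋x = solve-∀ ℚ[X]-acr

1≤ₚ⇒Positive : ∀ {p} → 1ₚ ≤ₚ p → Positive p
1≤ₚ⇒Positive {p} 1≤p = Positive-resp (1+[p-1]≋p p) (Positive-+ Positive-1ₚ 1≤p)
  where
  1+[p-1]≋p : ∀ p → 1ₚ +ₚ (p -ₚ 1ₚ) ≋ p
  1+[p-1]≋p = solve-∀ ℚ[X]-acr

NonNegative⇒0≤ₚ : ∀ {p} → NonNegative p → 0ₚ ≤ₚ p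
NonNegative⇒0≤ₚ {p} = NonNegative-resp (≋-sym (+-identityʳ p))

≤ₚ-resp : ∀ {p p′ q q′} → p ≋ p′ → q ≋ q′ → p ≤ₚ q → p′ ≤ₚ q′
≤ₚ-resp p≋p′ q≋q′ = NonNegative-resp (+-cong q≋q′ (·-congʳ (ℚ.- 1ℚ) p≋p′))

≤ₚ-reflexive : ∀ {p q} → p ≋ q → p ≤ₚ q
≤ₚ-reflexive {p} {q} p≋q = inj₁ (≋-trans (+-cong (≋-sym p≋q) ≋-refl) (+-inverseʳ p))

coeff≥0 : ∀ {n p} → NonNegative p → Deg≤ n p → 0ℚ ℚ.≤ coeff p n
coeff≥0 {n} (inj₁ p≋0) _ = ℚP.≤-reflexive (sym (coeff-≡ p≋0 n))
coeff≥0 {n} (inj₂ (mkPositive {i} x>0 t)) dn with ℕP.<-cmp i n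
... | tri< i<n _ _  = ℚP.≤-reflexive (sym (vanish (deg≤ t) i<n))
... | tri≈ _ refl _ = ℚP.<⇒≤ (subst (0ℚ ℚ.<_) (sym (coeff-top t)) x>0)
... | tri> _ _ n<i  = ⊥-elim (>0⇒≢0 x>0 (trans (sym (coeff-top t)) (vanish dn n<i)))

degree< : ∀ {n p} (p>0 : Positive p) → Deg≤ n p → coeff p n ≡ 0ℚ → degree p>0 ℕ.< n
degree< {n} {p} (mkPositive {i} x>0 t) dn p[n]≡0 =
  ℕP.≤∧≢⇒< (coeff≢0⇒≤ dn x≢0) λ { refl → x≢0 p[n]≡0 }
  where
  x≢0 : coeff p i ≢ 0ℚ
  x≢0 = subst (_≢ 0ℚ) (sym (coeff-top t)) (>0⇒≢0 x>0)

degree≤ : ∀ {n p} (p>0 : Positive p) → Deg≤ n p → degree p>0 ℕ.≤ n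
degree≤ (mkPositive x>0 t) dn = coeff≢0⇒≤ dn (λ z → >0⇒≢0 x>0 (trans (sym (coeff-top t)) z))

degree≡ : ∀ {n p} (p>0 : Positive p) → Deg≤ n p → coeff p n ≢ 0ℚ → degree p>0 ≡ n
degree≡ p>0 dp p[n]≢0 = ℕP.≤-antisym (degree≤ p>0 dp) (coeff≢0⇒≤ (deg≤ (top p>0)) p[n]≢0)

IntConst-resp : ∀ {p q} → p ≋ q → IntConst p → IntConst q
IntConst-resp (mk≋ e) (z , p[0]≡z) = z , trans (sym (e 0)) p[0]≡z

IntConst-+ : ∀ p q → IntConst p → IntConst q → IntConst (p +ₚ q)
IntConst-+ p q ip iq = subst Integral (sym (coeff-+ p q 0)) (Integral-+ ip iq)

IntConst-neg : ∀ p → IntConst p → IntConst (-ₚ p)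
IntConst-neg p ip = subst Integral (sym (coeff-neg p 0)) (Integral-neg ip)

IntConst-minus : ∀ p q → IntConst p → IntConst q → IntConst (p -ₚ q)
IntConst-minus p q ip iq = IntConst-+ p (-ₚ q) ip (IntConst-neg q iq)

IntConst-* : ∀ p q → IntConst p → IntConst q → IntConst (p *ₚ q)
IntConst-* p q ip iq = subst Integral (sym (coeff-*-0 p q)) (Integral-* ip iq)

IntConst-0ₚ : IntConst 0ₚ
IntConst-0ₚ = + 0 , refl

IntConst-1ₚ : IntConst 1ₚ
IntConst-1ₚ = + 1 , refl

record 𝕄₂ (p : Poly) : Set where
  constructor mk𝕄₂
  field
    nonNeg   : NonNegative p
    intConst : IntConst p
open 𝕄₂ public

record 𝕄₂⁺ (p : Poly) : Set where
  constructor mk𝕄₂⁺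
  field
    pos      : Positive p
    intConst : IntConst p
open 𝕄₂⁺ public

𝕄₂⁺⇒𝕄₂ : ∀ {p} → 𝕄₂⁺ p → 𝕄₂ p
𝕄₂⁺⇒𝕄₂ (mk𝕄₂⁺ p>0 ip) = mk𝕄₂ (inj₂ p>0) ip

𝕄₂-resp : ∀ {p q} → p ≋ q → 𝕄₂ p → 𝕄₂ q
𝕄₂-resp p≋q (mk𝕄₂ p≥0 ip) = mk𝕄₂ (NonNegative-resp p≋q p≥0) (IntConst-resp p≋q ip)

𝕄₂-+ : ∀ {p q} → 𝕄₂ p → 𝕄₂ q → 𝕄₂ (p +ₚ q)
𝕄₂-+ {p} {q} (mk𝕄₂ p≥0 ip) (mk𝕄₂ q≥0 iq) = mk𝕄₂ (NonNegative-+ p≥0 q≥0) (IntConst-+ p q ip iq)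

𝕄₂-* : ∀ {p q} → 𝕄₂ p → 𝕄₂ q → 𝕄₂ (p *ₚ q)
𝕄₂-* {p} {q} (mk𝕄₂ p≥0 ip) (mk𝕄₂ q≥0 iq) = mk𝕄₂ (NonNegative-* p≥0 q≥0) (IntConst-* p q ip iq)

𝕄₂⁺-+ : ∀ {p q} → 𝕄₂⁺ p → 𝕄₂⁺ q → 𝕄₂⁺ (p +ₚ q)
𝕄₂⁺-+ {p} {q} (mk𝕄₂⁺ p>0 ip) (mk𝕄₂⁺ q>0 iq) =
  mk𝕄₂⁺ (Positive-+ p>0 (inj₂ q>0)) (IntConst-+ p q ip iq)

NonNegative-const : ∀ {p} → Deg≤ 0 p → 0ℚ ℚ.≤ coeff p 0 → NonNegative p
NonNegative-const {p} d p[0]≥0 with ℚP.<-cmp 0ℚ (coeff p 0)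
... | tri< p[0]>0 _ _ = inj₂ (mkPositive p[0]>0 (mkTopTerm d refl))
... | tri≈ _ 0≡p[0] _ = inj₁ (Deg≤0⇒≋0 d (sym 0≡p[0]))
... | tri> _ _ p[0]<0 = ⊥-elim (ℚP.<-irrefl refl (ℚP.<-≤-trans p[0]<0 p[0]≥0))

-- In degree 0 this is the integrality of the constant term; in higher degree subtracting 1 keeps the top term.
𝕄₂⁺⇒1≤ₚ : ∀ {p} → 𝕄₂⁺ p → 1ₚ ≤ₚ p
𝕄₂⁺⇒1≤ₚ {p} (mk𝕄₂⁺ (mkPositive {suc n} x>0 t) _) =
  inj₂ (mkPositive x>0 (TopTerm-resp (+-comm (-ₚ 1ₚ) p)
                          (TopTerm-+ˡ (ℕ.s≤s ℕ.z≤n) (Deg≤-· (ℚ.- 1ℚ) (deg≤ TopTerm-1ₚ)) t)))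
𝕄₂⁺⇒1≤ₚ {p} (mk𝕄₂⁺ (mkPositive {zero} x>0 t) ip) =
  NonNegative-const (Deg≤-minus (deg≤ t) (deg≤ TopTerm-1ₚ))
    (subst (0ℚ ℚ.≤_) (sym (coeff-minus p 1ₚ 0))
           (x≥1⇒x-1≥0 (Integral-pos⇒≥1 ip (subst (0ℚ ℚ.<_) (sym (coeff-top t)) x>0))))
  where
  x≥1⇒x-1≥0 : ∀ {x} → 1ℚ ℚ.≤ x → 0ℚ ℚ.≤ x ℚ.- 1ℚ
  x≥1⇒x-1≥0 {x} x≥1 = subst (ℚ._≤ x ℚ.- 1ℚ) (ℚP.+-inverseʳ 1ℚ) (ℚP.+-monoˡ-≤ (ℚ.- 1ℚ) x≥1)

𝕄₂-nonzero : ∀ {p} → 𝕄₂ p → ¬ p ≋ 0ₚ → 𝕄₂⁺ p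
𝕄₂-nonzero (mk𝕄₂ (inj₁ p≋0) _)  p≉0 = ⊥-elim (p≉0 p≋0)
𝕄₂-nonzero (mk𝕄₂ (inj₂ p>0) ip) _   = mk𝕄₂⁺ p>0 ip

𝕄₂-unit : ∀ {p q} → 𝕄₂ p → 𝕄₂ q → p *ₚ q ≋ 1ₚ → p ≋ 1ₚ
𝕄₂-unit {p} {q} p∈ q∈ pq≋1 = ≤ₚ-antisym p≤1 (𝕄₂⁺⇒1≤ₚ p∈⁺)
  where
  1≉0 : ¬ 1ₚ ≋ 0ₚ
  1≉0 = Positive⇒≉0 Positive-1ₚ
  p∈⁺ : 𝕄₂⁺ p
  p∈⁺ = 𝕄₂-nonzero p∈ λ p≋0 → 1≉0 (≋-trans (≋-sym pq≋1) (*-congˡ q p≋0))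
  q∈⁺ : 𝕄₂⁺ q
  q∈⁺ = 𝕄₂-nonzero q∈ λ q≋0 → 1≉0 (≋-trans (≋-sym pq≋1) (≋-trans (*-congʳ p q≋0) (*-zeroʳ p)))
  factor : ∀ p q → p *ₚ (q -ₚ 1ₚ) ≋ p *ₚ q -ₚ p
  factor = solve-∀ ℚ[X]-acr
  p≤1 : p ≤ₚ 1ₚ
  p≤1 = NonNegative-resp (≋-trans (factor p q) (+-cong pq≋1 ≋-refl))
          (NonNegative-* (inj₂ (pos p∈⁺)) (𝕄₂⁺⇒1≤ₚ q∈⁺))

NonNeg⇒NonNegative : ∀ {p} → NonNeg p → NonNegative p
NonNeg⇒NonNegative (inj₁ p≈0) = inj₁ (mk≋ p≈0)
NonNeg⇒NonNegative (inj₂ (n , p[n]>0 , van)) = inj₂ (mkPositive p[n]>0 (mkTopTerm (mkDeg≤ (van _)) refl))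

InM₂⇒𝕄₂ : ∀ {p} → InM₂ p → 𝕄₂ p
InM₂⇒𝕄₂ (ip , p≥0) = mk𝕄₂ (NonNeg⇒NonNegative p≥0) ip

GoodFactor⇒𝕄₂⁺ : ∀ f → GoodFactor f → 𝕄₂⁺ (param f)
GoodFactor⇒𝕄₂⁺ f ((_  , inj₁ p≈0) , p≉0) = ⊥-elim (p≉0 p≈0)
GoodFactor⇒𝕄₂⁺ f ((ip , inj₂ (_ , p[n]>0 , van)) , _) =
  mk𝕄₂⁺ (mkPositive p[n]>0 (mkTopTerm (mkDeg≤ (van _)) refl)) ip

𝕄₂⁺⇒GoodFactor : ∀ f → 𝕄₂⁺ (param f) → GoodFactor f
𝕄₂⁺⇒GoodFactor f (mk𝕄₂⁺ p>0@(mkPositive lead>0 (mkTopTerm (mkDeg≤ van) p[n]≡lead)) ip) =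
  (ip , inj₂ (_ , subst (0ℚ ℚ.<_) (sym p[n]≡lead) lead>0 , λ _ → van)) ,
  λ p≈0 → Positive⇒≉0 p>0 (mk≋ p≈0)

infix 4 _≋ₘ_
record _≋ₘ_ (M N : Mat) : Set where
  constructor mk≋ₘ
  field
    a≋ : a M ≋ a N
    b≋ : b M ≋ b N
    c≋ : c M ≋ c N
    d≋ : d M ≋ d N
open _≋ₘ_ public

≋ₘ-refl : ∀ {M} → M ≋ₘ M
≋ₘ-refl = mk≋ₘ ≋-refl ≋-refl ≋-refl ≋-refl

≋ₘ-sym : ∀ {M N} → M ≋ₘ N → N ≋ₘ M
≋ₘ-sym (mk≋ₘ ea eb ec ed) = mk≋ₘ (≋-sym ea) (≋-sym eb) (≋-sym ec) (≋-sym ed)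

≋ₘ-trans : ∀ {M N O} → M ≋ₘ N → N ≋ₘ O → M ≋ₘ O
≋ₘ-trans (mk≋ₘ ea eb ec ed) (mk≋ₘ fa fb fc fd) =
  mk≋ₘ (≋-trans ea fa) (≋-trans eb fb) (≋-trans ec fc) (≋-trans ed fd)

*ₘ-cong : ∀ {M M′ N N′} → M ≋ₘ M′ → N ≋ₘ N′ → M *ₘ N ≋ₘ M′ *ₘ N′
*ₘ-cong (mk≋ₘ ea eb ec ed) (mk≋ₘ fa fb fc fd) =
  mk≋ₘ (+-cong (*-cong ea fa) (*-cong eb fc)) (+-cong (*-cong ea fb) (*-cong eb fd))
       (+-cong (*-cong ec fa) (*-cong ed fc)) (+-cong (*-cong ec fb) (*-cong ed fd))

*ₘ-congˡ : ∀ M {N N′} → N ≋ₘ N′ → M *ₘ N ≋ₘ M *ₘ N′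
*ₘ-congˡ M = *ₘ-cong (≋ₘ-refl {M})

det-cong : ∀ {M N} → M ≋ₘ N → det M ≋ det N
det-cong (mk≋ₘ ea eb ec ed) = +-cong (*-cong ea ed) (·-congʳ (ℚ.- 1ℚ) (*-cong eb ec))

A-action : ∀ P N → toMat (A P) *ₘ N ≋ₘ mat (a N +ₚ P *ₚ c N) (b N +ₚ P *ₚ d N) (c N) (d N)
A-action P N = mk≋ₘ (upper P (a N) (c N)) (upper P (b N) (d N)) (lower (a N) (c N)) (lower (b N) (d N))
  where
  upper : ∀ P x y → 1ₚ *ₚ x +ₚ P *ₚ y ≋ x +ₚ P *ₚ y
  upper = solve-∀ ℚ[X]-acr
  lower : ∀ x y → 0ₚ *ₚ x +ₚ 1ₚ *ₚ y ≋ y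
  lower = solve-∀ ℚ[X]-acr

B-action : ∀ Q N → toMat (B Q) *ₘ N ≋ₘ mat (a N) (b N) (Q *ₚ a N +ₚ c N) (Q *ₚ b N +ₚ d N)
B-action Q N = mk≋ₘ (upper (a N) (c N)) (upper (b N) (d N)) (lower Q (a N) (c N)) (lower Q (b N) (d N))
  where
  upper : ∀ x y → 1ₚ *ₚ x +ₚ 0ₚ *ₚ y ≋ x
  upper = solve-∀ ℚ[X]-acr
  lower : ∀ Q x y → Q *ₚ x +ₚ 1ₚ *ₚ y ≋ Q *ₚ x +ₚ y
  lower = solve-∀ ℚ[X]-acr

det-A* : ∀ P N → det (toMat (A P) *ₘ N) ≋ det N
det-A* P N = ≋-trans (det-cong (A-action P N)) (det-row-op P (a N) (b N) (c N) (d N))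
  where
  det-row-op : ∀ P a b c d → (a +ₚ P *ₚ c) *ₚ d -ₚ (b +ₚ P *ₚ d) *ₚ c ≋ a *ₚ d -ₚ b *ₚ c
  det-row-op = solve-∀ ℚ[X]-acr

det-Iₘ : det Iₘ ≋ 1ₚ
det-Iₘ = mk≋ λ { zero → refl ; (suc zero) → refl ; (suc (suc n)) → refl }

A-+ : ∀ P P′ N → toMat (A (P +ₚ P′)) *ₘ N ≋ₘ toMat (A P) *ₘ (toMat (A P′) *ₘ N)
A-+ P P′ N = ≋ₘ-trans (A-action (P +ₚ P′) N) (≋ₘ-trans
  (mk≋ₘ (split P P′ (a N) (c N)) (split P P′ (b N) (d N)) ≋-refl ≋-refl)
  (≋ₘ-sym (≋ₘ-trans (*ₘ-congˡ (toMat (A P)) (A-action P′ N)) (A-action P _))))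
  where
  split : ∀ P P′ x y → x +ₚ (P +ₚ P′) *ₚ y ≋ (x +ₚ P′ *ₚ y) +ₚ P *ₚ y
  split = solve-∀ ℚ[X]-acr

B-+ : ∀ Q Q′ N → toMat (B (Q +ₚ Q′)) *ₘ N ≋ₘ toMat (B Q) *ₘ (toMat (B Q′) *ₘ N)
B-+ Q Q′ N = ≋ₘ-trans (B-action (Q +ₚ Q′) N) (≋ₘ-trans
  (mk≋ₘ ≋-refl ≋-refl (split Q Q′ (a N) (c N)) (split Q Q′ (b N) (d N)))
  (≋ₘ-sym (≋ₘ-trans (*ₘ-congˡ (toMat (B Q)) (B-action Q′ N)) (B-action Q _))))
  where
  split : ∀ Q Q′ x y → (Q +ₚ Q′) *ₚ x +ₚ y ≋ Q *ₚ x +ₚ (Q′ *ₚ x +ₚ y)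
  split = solve-∀ ℚ[X]-acr

-- Conjugation by the antidiagonal matrix (0 1 ; 1 0); it exchanges A^P and B^P.
swap : Mat → Mat
swap (mat a b c d) = mat d c b a

swap-cong : ∀ {M N} → M ≋ₘ N → swap M ≋ₘ swap N
swap-cong (mk≋ₘ ea eb ec ed) = mk≋ₘ ed ec eb ea

swap-*ₘ : ∀ M N → swap (M *ₘ N) ≋ₘ swap M *ₘ swap N
swap-*ₘ (mat a₁ b₁ c₁ d₁) (mat a₂ b₂ c₂ d₂) =
  mk≋ₘ (+-comm (c₁ *ₚ b₂) (d₁ *ₚ d₂)) (+-comm (c₁ *ₚ a₂) (d₁ *ₚ c₂))
       (+-comm (a₁ *ₚ b₂) (b₁ *ₚ d₂)) (+-comm (a₁ *ₚ a₂) (b₁ *ₚ c₂))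

det-swap : ∀ M → det (swap M) ≋ det M
det-swap M = det-swapped (a M) (b M) (c M) (d M)
  where
  det-swapped : ∀ a b c d → d *ₚ a -ₚ c *ₚ b ≋ a *ₚ d -ₚ b *ₚ c
  det-swapped = solve-∀ ℚ[X]-acr

swap-B* : ∀ Q N → swap (toMat (B Q) *ₘ N) ≋ₘ toMat (A Q) *ₘ swap N
swap-B* Q N = swap-*ₘ (toMat (B Q)) N

peelA : Poly → Mat → Mat
peelA P M = mat (a M -ₚ P *ₚ c M) (b M -ₚ P *ₚ d M) (c M) (d M)

A-peelA : ∀ P M → toMat (A P) *ₘ peelA P M ≋ₘ M
A-peelA P M = ≋ₘ-trans (A-action P (peelA P M))
                       (mk≋ₘ (cancel P (a M) (c M)) (cancel P (b M) (d M)) ≋-refl ≋-refl)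
  where
  cancel : ∀ P x y → (x -ₚ P *ₚ y) +ₚ P *ₚ y ≋ x
  cancel = solve-∀ ℚ[X]-acr

peelA-cong : ∀ P {M N} → M ≋ₘ N → peelA P M ≋ₘ peelA P N
peelA-cong P (mk≋ₘ ea eb ec ed) =
  mk≋ₘ (+-cong ea (·-congʳ (ℚ.- 1ℚ) (*-congʳ P ec))) (+-cong eb (·-congʳ (ℚ.- 1ℚ) (*-congʳ P ed))) ec ed

peelA-A : ∀ P Q N → peelA P (toMat (A Q) *ₘ N) ≋ₘ toMat (A (Q -ₚ P)) *ₘ N
peelA-A P Q N = ≋ₘ-trans (peelA-cong P (A-action Q N)) (≋ₘ-trans
  (mk≋ₘ (shift P Q (a N) (c N)) (shift P Q (b N) (d N)) ≋-refl ≋-refl)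
  (≋ₘ-sym (A-action (Q -ₚ P) N)))
  where
  shift : ∀ P Q x y → (x +ₚ Q *ₚ y) -ₚ P *ₚ y ≋ x +ₚ (Q -ₚ P) *ₚ y
  shift = solve-∀ ℚ[X]-acr

A-zero : ∀ {P} N → P ≋ 0ₚ → toMat (A P) *ₘ N ≋ₘ N
A-zero {P} N P≋0 = ≋ₘ-trans (A-action P N) (mk≋ₘ (drop (a N) (c N)) (drop (b N) (d N)) ≋-refl ≋-refl)
  where
  drop : ∀ x y → x +ₚ P *ₚ y ≋ x
  drop x y = ≋-trans (+-cong ≋-refl (*-congˡ y P≋0)) (+-identityʳ x)

det-peelA : ∀ P M → det (peelA P M) ≋ det M
det-peelA P M = ≋-trans (≋-sym (det-A* P (peelA P M))) (det-cong (A-peelA P M))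

record Entrywise (P : Poly → Set) (M : Mat) : Set where
  constructor entrywise
  field
    on-a : P (a M)
    on-b : P (b M)
    on-c : P (c M)
    on-d : P (d M)
open Entrywise public

Entrywise-resp : ∀ {P} → (∀ {p q} → p ≋ q → P p → P q) →
                 ∀ {M N} → M ≋ₘ N → Entrywise P M → Entrywise P N
Entrywise-resp resp (mk≋ₘ ea eb ec ed) (entrywise pa pb pc pd) =
  entrywise (resp ea pa) (resp eb pb) (resp ec pc) (resp ed pd)

Entrywise-swap : ∀ {P M} → Entrywise P M → Entrywise P (swap M)
Entrywise-swap (entrywise pa pb pc pd) = entrywise pd pc pb pa

record SL₂𝕄₂ (M : Mat) : Set where
  constructor mkSL₂𝕄₂
  field
    entries : Entrywise 𝕄₂ M
    det≋1   : det M ≋ 1ₚ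
open SL₂𝕄₂ public

SL₂𝕄₂-resp : ∀ {M N} → M ≋ₘ N → SL₂𝕄₂ M → SL₂𝕄₂ N
SL₂𝕄₂-resp M≋N (mkSL₂𝕄₂ m det≋1) =
  mkSL₂𝕄₂ (Entrywise-resp 𝕄₂-resp M≋N m) (≋-trans (≋-sym (det-cong M≋N)) det≋1)

SL₂𝕄₂-swap : ∀ {M} → SL₂𝕄₂ M → SL₂𝕄₂ (swap M)
SL₂𝕄₂-swap {M} (mkSL₂𝕄₂ m det≋1) = mkSL₂𝕄₂ (Entrywise-swap m) (≋-trans (det-swap M) det≋1)

SL₂𝕄₂-Iₘ : SL₂𝕄₂ Iₘ
SL₂𝕄₂-Iₘ = mkSL₂𝕄₂ (entrywise 1∈ 0∈ 0∈ 1∈) det-Iₘ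
  where
  1∈ : 𝕄₂ 1ₚ
  1∈ = 𝕄₂⁺⇒𝕄₂ (mk𝕄₂⁺ Positive-1ₚ IntConst-1ₚ)
  0∈ : 𝕄₂ 0ₚ
  0∈ = mk𝕄₂ (inj₁ ≋-refl) IntConst-0ₚ

SL₂𝕄₂-A : ∀ {P N} → 𝕄₂ P → SL₂𝕄₂ N → SL₂𝕄₂ (toMat (A P) *ₘ N)
SL₂𝕄₂-A {P} {N} P∈ (mkSL₂𝕄₂ (entrywise a b c d) det≋1) = mkSL₂𝕄₂
  (Entrywise-resp 𝕄₂-resp (≋ₘ-sym (A-action P N))
                  (entrywise (𝕄₂-+ a (𝕄₂-* P∈ c)) (𝕄₂-+ b (𝕄₂-* P∈ d)) c d))
  (≋-trans (det-A* P N) det≋1)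

SL₂𝕄₂-B : ∀ {Q N} → 𝕄₂ Q → SL₂𝕄₂ N → SL₂𝕄₂ (toMat (B Q) *ₘ N)
SL₂𝕄₂-B {Q} {N} Q∈ s =
  SL₂𝕄₂-resp (swap-cong (≋ₘ-sym (swap-B* Q N))) (SL₂𝕄₂-swap (SL₂𝕄₂-A Q∈ (SL₂𝕄₂-swap s)))

SL₂𝕄₂-peelA : ∀ P {M} → IntConst P → P *ₚ c M ≤ₚ a M → P *ₚ d M ≤ₚ b M →
              SL₂𝕄₂ M → SL₂𝕄₂ (peelA P M)
SL₂𝕄₂-peelA P {M} iP Pc≤a Pd≤b (mkSL₂𝕄₂ (entrywise a∈ b∈ c∈ d∈) det≋1) =
  mkSL₂𝕄₂ (entrywise (mk𝕄₂ Pc≤a (int-minus (a M) (c M) (intConst a∈) (intConst c∈)))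
                   (mk𝕄₂ Pd≤b (int-minus (b M) (d M) (intConst b∈) (intConst d∈))) c∈ d∈)
          (≋-trans (det-peelA P M) det≋1)
  where
  int-minus : ∀ x y → IntConst x → IntConst y → IntConst (x -ₚ P *ₚ y)
  int-minus x y ix iy = IntConst-minus x (P *ₚ y) ix (IntConst-* P y iP iy)

det≋1⇒a>0 : ∀ {M} → det M ≋ 1ₚ → NonNegative (b M) → NonNegative (c M) → Positive (d M) → Positive (a M)
det≋1⇒a>0 {M} det≋1 b≥0 c≥0 d>0 = Positive-cancelʳ d>0
  (Positive-resp (≋-sym ad≋bc+1) (Positive-resp (+-comm 1ₚ _) (Positive-+ Positive-1ₚ (NonNegative-* b≥0 c≥0))))
  where
  rearrange : ∀ a b c d → a *ₚ d ≋ b *ₚ c +ₚ (a *ₚ d -ₚ b *ₚ c)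
  rearrange = solve-∀ ℚ[X]-acr
  ad≋bc+1 : a M *ₚ d M ≋ b M *ₚ c M +ₚ 1ₚ
  ad≋bc+1 = ≋-trans (rearrange (a M) (b M) (c M) (d M)) (+-cong ≋-refl det≋1)

SL₂𝕄₂⇒d>0 : ∀ {M} → SL₂𝕄₂ M → Positive (d M)
SL₂𝕄₂⇒d>0 {M} (mkSL₂𝕄₂ (entrywise _ b∈ c∈ d∈) det≋1) = pos (𝕄₂-nonzero d∈ d≉0)
  where
  rearrange : ∀ a b c d → b *ₚ c ≋ a *ₚ d -ₚ (a *ₚ d -ₚ b *ₚ c)
  rearrange = solve-∀ ℚ[X]-acr
  d≉0 : ¬ d M ≋ 0ₚ
  d≉0 d≋0 = ¬1≤ₚ0 (NonNegative-resp
    (≋-trans (rearrange (a M) (b M) (c M) (d M))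
             (+-cong (≋-trans (*-congʳ (a M) d≋0) (*-zeroʳ (a M))) (·-congʳ (ℚ.- 1ℚ) det≋1)))
    (NonNegative-* (nonNeg b∈) (nonNeg c∈)))

-- Matrices of A-type and B-type

record AType (M : Mat) : Set where
  constructor mkAType
  field
    c≤a : c M ≤ₚ a M
    d≤b : d M ≤ₚ b M
open AType public

BType : Mat → Set
BType M = AType (swap M)

AType-resp : ∀ {M N} → M ≋ₘ N → AType M → AType N
AType-resp (mk≋ₘ ea eb ec ed) (mkAType c≤a d≤b) = mkAType (≤ₚ-resp ec ea c≤a) (≤ₚ-resp ed eb d≤b)

BType-resp : ∀ {M N} → M ≋ₘ N → BType M → BType N
BType-resp M≋N = AType-resp (swap-cong M≋N)

¬AType-Iₘ : ¬ AType Iₘ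
¬AType-Iₘ (mkAType _ 1≤0) = ¬1≤ₚ0 1≤0

¬BType-Iₘ : ¬ BType Iₘ
¬BType-Iₘ = ¬AType-Iₘ

¬AType∧BType : ∀ {M} → det M ≋ 1ₚ → AType M → BType M → ⊥
¬AType∧BType {M} det≋1 (mkAType c≤a d≤b) (mkAType b≤d a≤c) =
  Positive⇒≉0 Positive-1ₚ (≋-trans (≋-sym det≋1) (≋-trans (det-cong a≋c∧b≋d) (cross (c M) (d M))))
  where
  a≋c∧b≋d : M ≋ₘ mat (c M) (d M) (c M) (d M)
  a≋c∧b≋d = mk≋ₘ (≤ₚ-antisym a≤c c≤a) (≤ₚ-antisym b≤d d≤b) ≋-refl ≋-refl
  cross : ∀ x y → x *ₚ y -ₚ y *ₚ x ≋ 0ₚ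
  cross = solve-∀ ℚ[X]-acr

AType-A : ∀ {P N} → 𝕄₂⁺ P → Entrywise 𝕄₂ N → AType (toMat (A P) *ₘ N)
AType-A {P} {N} P∈ (entrywise a∈ b∈ c∈ d∈) = AType-resp (≋ₘ-sym (A-action P N))
  (mkAType (below (a N) (c N) (nonNeg a∈) (nonNeg c∈)) (below (b N) (d N) (nonNeg b∈) (nonNeg d∈)))
  where
  rearrange : ∀ P x y → (x +ₚ P *ₚ y) -ₚ y ≋ x +ₚ (P -ₚ 1ₚ) *ₚ y
  rearrange = solve-∀ ℚ[X]-acr
  below : ∀ x y → NonNegative x → NonNegative y → y ≤ₚ x +ₚ P *ₚ y
  below x y x≥0 y≥0 =
    NonNegative-resp (≋-sym (rearrange P x y)) (NonNegative-+ x≥0 (NonNegative-* (𝕄₂⁺⇒1≤ₚ P∈) y≥0))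

BType-B : ∀ {Q N} → 𝕄₂⁺ Q → Entrywise 𝕄₂ N → BType (toMat (B Q) *ₘ N)
BType-B {Q} {N} Q∈ m = AType-resp (≋ₘ-sym (swap-B* Q N)) (AType-A Q∈ (Entrywise-swap m))

d≤b⇒c≤a : ∀ {M} → SL₂𝕄₂ M → d M ≤ₚ b M → c M ≤ₚ a M
d≤b⇒c≤a {M} (mkSL₂𝕄₂ (entrywise _ _ c∈ d∈) det≋1) d≤b with ≤ₚ-total (c M) (a M)
... | inj₁ c≤a = c≤a
... | inj₂ a<c = ⊥-elim (¬1≤ₚ0 (NonNegative-resp minus-det
        (NonNegative-+ (NonNegative-* (nonNeg d∈) (inj₂ a<c)) (NonNegative-* (nonNeg c∈) d≤b))))
  where
  expand : ∀ a b c d → d *ₚ (c -ₚ a) +ₚ c *ₚ (b -ₚ d) ≋ 0ₚ -ₚ (a *ₚ d -ₚ b *ₚ c)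
  expand = solve-∀ ℚ[X]-acr
  minus-det : d M *ₚ (c M -ₚ a M) +ₚ c M *ₚ (b M -ₚ d M) ≋ 0ₚ -ₚ 1ₚ
  minus-det = ≋-trans (expand (a M) (b M) (c M) (d M)) (+-cong (≋-refl {0ₚ}) (·-congʳ (ℚ.- 1ℚ) det≋1))

-- With u = a - c ≥ 1 and v = d - b ≥ 1, det M - 1 is a sum of four non-negative terms.
c<a∧b<d⇒≋Iₘ : ∀ {M} → SL₂𝕄₂ M → c M <ₚ a M → b M <ₚ d M → M ≋ₘ Iₘ
c<a∧b<d⇒≋Iₘ {M} (mkSL₂𝕄₂ (entrywise a∈ b∈ c∈ d∈) det≋1) u>0 v>0 =
  mk≋ₘ (unit (a M) (c M) c≋0 (NonNegative-*-zero u≥1 v>0 (proj₂ split₂))) b≋0 c≋0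
       (unit (d M) (b M) b≋0 (proj₂ split₁))
  where
  u v t₁ t₂ t₃ t₄ : Poly
  u = a M -ₚ c M
  v = d M -ₚ b M
  t₁ = c M *ₚ v
  t₂ = b M *ₚ u
  t₃ = (u -ₚ 1ₚ) *ₚ v
  t₄ = v -ₚ 1ₚ
  u≥1 : 1ₚ ≤ₚ u
  u≥1 = 𝕄₂⁺⇒1≤ₚ (mk𝕄₂⁺ u>0 (IntConst-minus (a M) (c M) (intConst a∈) (intConst c∈)))
  v≥1 : 1ₚ ≤ₚ v
  v≥1 = 𝕄₂⁺⇒1≤ₚ (mk𝕄₂⁺ v>0 (IntConst-minus (d M) (b M) (intConst d∈) (intConst b∈)))
  t₁≥0 : NonNegative t₁
  t₁≥0 = NonNegative-* (nonNeg c∈) (inj₂ v>0)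
  t₂≥0 : NonNegative t₂
  t₂≥0 = NonNegative-* (nonNeg b∈) (inj₂ u>0)
  t₃≥0 : NonNegative t₃
  t₃≥0 = NonNegative-* u≥1 (inj₂ v>0)
  expand : ∀ a b c d →
           ((c *ₚ (d -ₚ b) +ₚ b *ₚ (a -ₚ c)) +ₚ ((a -ₚ c) -ₚ 1ₚ) *ₚ (d -ₚ b)) +ₚ ((d -ₚ b) -ₚ 1ₚ)
           ≋ (a *ₚ d -ₚ b *ₚ c) -ₚ 1ₚ
  expand = solve-∀ ℚ[X]-acr
  split₁ : (t₁ +ₚ t₂) +ₚ t₃ ≋ 0ₚ × t₄ ≋ 0ₚ
  split₁ = NonNegative-+-zero (NonNegative-+ (NonNegative-+ t₁≥0 t₂≥0) t₃≥0) v≥1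
             (≋-trans (expand (a M) (b M) (c M) (d M)) (≋-trans (+-cong det≋1 ≋-refl) (+-inverseʳ 1ₚ)))
  split₂ : t₁ +ₚ t₂ ≋ 0ₚ × t₃ ≋ 0ₚ
  split₂ = NonNegative-+-zero (NonNegative-+ t₁≥0 t₂≥0) t₃≥0 (proj₁ split₁)
  split₃ : t₁ ≋ 0ₚ × t₂ ≋ 0ₚ
  split₃ = NonNegative-+-zero t₁≥0 t₂≥0 (proj₁ split₂)
  c≋0 : c M ≋ 0ₚ
  c≋0 = NonNegative-*-zero (nonNeg c∈) v>0 (proj₁ split₃)
  b≋0 : b M ≋ 0ₚ
  b≋0 = NonNegative-*-zero (nonNeg b∈) u>0 (proj₂ split₃)
  decompose : ∀ x y → x ≋ (y +ₚ ((x -ₚ y) -ₚ 1ₚ)) +ₚ 1ₚ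
  decompose = solve-∀ ℚ[X]-acr
  unit : ∀ x y → y ≋ 0ₚ → (x -ₚ y) -ₚ 1ₚ ≋ 0ₚ → x ≋ 1ₚ
  unit x y y≋0 x-y-1≋0 = ≋-trans (decompose x y) (+-cong (+-cong y≋0 x-y-1≋0) ≋-refl)

classify : ∀ {M} → SL₂𝕄₂ M → M ≋ₘ Iₘ ⊎ AType M ⊎ BType M
classify {M} s with ≤ₚ-total (d M) (b M)
... | inj₁ d≤b = inj₂ (inj₁ (mkAType (d≤b⇒c≤a s d≤b) d≤b))
... | inj₂ b<d with ≤ₚ-total (c M) (a M)
...   | inj₂ a<c          = inj₂ (inj₂ (mkAType (inj₂ b<d) (inj₂ a<c)))
...   | inj₁ (inj₁ a-c≋0) =
  inj₂ (inj₂ (mkAType (inj₂ b<d) (≤ₚ-reflexive (minus≋0⇒≋ {a M} {c M} a-c≋0))))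
...   | inj₁ (inj₂ c<a)   = inj₁ (c<a∧b<d⇒≋Iₘ s c<a b<d)

-- Uniqueness

prod-SL₂𝕄₂ : ∀ w → All GoodFactor w → SL₂𝕄₂ (prod w)
prod-SL₂𝕄₂ []        []       = SL₂𝕄₂-Iₘ
prod-SL₂𝕄₂ (A P ∷ w) (g ∷ gs) = SL₂𝕄₂-A (𝕄₂⁺⇒𝕄₂ (GoodFactor⇒𝕄₂⁺ (A P) g)) (prod-SL₂𝕄₂ w gs)
prod-SL₂𝕄₂ (B Q ∷ w) (g ∷ gs) = SL₂𝕄₂-B (𝕄₂⁺⇒𝕄₂ (GoodFactor⇒𝕄₂⁺ (B Q) g)) (prod-SL₂𝕄₂ w gs)

HeadType : Factor → Mat → Set
HeadType (A _) = AType
HeadType (B _) = BType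

OtherType : Factor → Mat → Set
OtherType (A _) = BType
OtherType (B _) = AType

prod-HeadType : ∀ f w → All GoodFactor (f ∷ w) → HeadType f (prod (f ∷ w))
prod-HeadType (A P) w (g ∷ gs) = AType-A (GoodFactor⇒𝕄₂⁺ (A P) g) (entries (prod-SL₂𝕄₂ w gs))
prod-HeadType (B Q) w (g ∷ gs) = BType-B (GoodFactor⇒𝕄₂⁺ (B Q) g) (entries (prod-SL₂𝕄₂ w gs))

HeadType-≉Iₘ : ∀ f {M} → HeadType f M → ¬ M ≋ₘ Iₘ
HeadType-≉Iₘ (A _) t M≋I = ¬AType-Iₘ (AType-resp M≋I t)
HeadType-≉Iₘ (B _) t M≋I = ¬BType-Iₘ (BType-resp M≋I t)

Alternating-tail : ∀ f w → Alternating (f ∷ w) → Alternating w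
Alternating-tail f []      _         = tt
Alternating-tail f (g ∷ w) (_ , alt) = alt

prod-tail-type : ∀ f w → Alternating (f ∷ w) → All GoodFactor w → prod w ≋ₘ Iₘ ⊎ OtherType f (prod w)
prod-tail-type f     []        _         _  = inj₁ ≋ₘ-refl
prod-tail-type (A _) (A _ ∷ w) (A≁A , _) _  = ⊥-elim (A≁A tt)
prod-tail-type (A _) (B Q ∷ w) _         gs = inj₂ (prod-HeadType (B Q) w gs)
prod-tail-type (B _) (A P ∷ w) _         gs = inj₂ (prod-HeadType (A P) w gs)
prod-tail-type (B _) (B _ ∷ w) (B≁B , _) _  = ⊥-elim (B≁B tt)

A-shift : ∀ P P′ N N′ → toMat (A P) *ₘ N ≋ₘ toMat (A P′) *ₘ N′ →
          N ≋ₘ toMat (A (P′ -ₚ P)) *ₘ N′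
A-shift P P′ N N′ E = ≋ₘ-trans (≋ₘ-sym (A-zero N (+-inverseʳ P)))
  (≋ₘ-trans (≋ₘ-sym (peelA-A P P N)) (≋ₘ-trans (peelA-cong P E) (peelA-A P P′ N′)))

IorB⇒¬AType : ∀ {N} → det N ≋ 1ₚ → N ≋ₘ Iₘ ⊎ BType N → ¬ AType N
IorB⇒¬AType _     (inj₁ N≋I) at = ¬AType-Iₘ (AType-resp N≋I at)
IorB⇒¬AType det≋1 (inj₂ bt)  at = ¬AType∧BType det≋1 at bt

-- If P < P′ then N = A^(P′ - P) N′ would be of A-type.
A-cancel : ∀ P P′ {N N′} → IntConst P → IntConst P′ → SL₂𝕄₂ N → SL₂𝕄₂ N′ →
           N ≋ₘ Iₘ ⊎ BType N → N′ ≋ₘ Iₘ ⊎ BType N′ →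
           toMat (A P) *ₘ N ≋ₘ toMat (A P′) *ₘ N′ → P ≋ P′ × N ≋ₘ N′
A-cancel P P′ {N} {N′} iP iP′ sN sN′ tN tN′ E with trichotomy (P′ -ₚ P)
... | inj₁ P′-P≋0 = ≋-sym (minus≋0⇒≋ P′-P≋0) , ≋ₘ-trans (A-shift P P′ N N′ E) (A-zero N′ P′-P≋0)
... | inj₂ (inj₁ P′-P>0) = ⊥-elim (IorB⇒¬AType (det≋1 sN) tN (AType-resp (≋ₘ-sym (A-shift P P′ N N′ E))
        (AType-A (mk𝕄₂⁺ P′-P>0 (IntConst-minus P′ P iP′ iP)) (entries sN′))))
... | inj₂ (inj₂ -[P′-P]>0) = ⊥-elim (IorB⇒¬AType (det≋1 sN′) tN′ (AType-resp (≋ₘ-sym (A-shift P′ P N′ N (≋ₘ-sym E)))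
        (AType-A (mk𝕄₂⁺ (Positive-resp (neg-minus P′ P) -[P′-P]>0) (IntConst-minus P P′ iP iP′)) (entries sN))))

B-cancel : ∀ Q Q′ {N N′} → IntConst Q → IntConst Q′ → SL₂𝕄₂ N → SL₂𝕄₂ N′ →
           N ≋ₘ Iₘ ⊎ AType N → N′ ≋ₘ Iₘ ⊎ AType N′ →
           toMat (B Q) *ₘ N ≋ₘ toMat (B Q′) *ₘ N′ → Q ≋ Q′ × N ≋ₘ N′
B-cancel Q Q′ {N} {N′} iQ iQ′ sN sN′ tN tN′ E = proj₁ cancelled , swap-cong (proj₂ cancelled)
  where
  swapped : toMat (A Q) *ₘ swap N ≋ₘ toMat (A Q′) *ₘ swap N′
  swapped = ≋ₘ-trans (≋ₘ-sym (swap-B* Q N)) (≋ₘ-trans (swap-cong E) (swap-B* Q′ N′))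
  cancelled : Q ≋ Q′ × swap N ≋ₘ swap N′
  cancelled = A-cancel Q Q′ iQ iQ′ (SL₂𝕄₂-swap sN) (SL₂𝕄₂-swap sN′)
                       (map₁ swap-cong tN) (map₁ swap-cong tN′) swapped

prod-injective : ∀ fs gs → ValidWord fs → ValidWord gs → prod fs ≋ₘ prod gs → Pointwise _≈F_ fs gs
prod-injective [] [] _ _ _ = []
prod-injective [] (g ∷ gs) _ (_ , all-g) E = ⊥-elim (HeadType-≉Iₘ g (prod-HeadType g gs all-g) (≋ₘ-sym E))
prod-injective (f ∷ fs) [] (_ , all-f) _ E = ⊥-elim (HeadType-≉Iₘ f (prod-HeadType f fs all-f) E)
prod-injective (A P ∷ fs) (B Q ∷ gs) (_ , all-f) (_ , all-g) E =
  ⊥-elim (¬AType∧BType (det≋1 (prod-SL₂𝕄₂ (A P ∷ fs) all-f)) (prod-HeadType (A P) fs all-f)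
                       (BType-resp (≋ₘ-sym E) (prod-HeadType (B Q) gs all-g)))
prod-injective (B Q ∷ fs) (A P ∷ gs) (_ , all-f) (_ , all-g) E =
  ⊥-elim (¬AType∧BType (det≋1 (prod-SL₂𝕄₂ (A P ∷ gs) all-g)) (prod-HeadType (A P) gs all-g)
                       (BType-resp E (prod-HeadType (B Q) fs all-f)))
prod-injective (A P ∷ fs) (A P′ ∷ gs) (alt-f , gf ∷ all-f) (alt-g , gg ∷ all-g) E =
  coeff-≡ (proj₁ cancelled) ∷ prod-injective fs gs (Alternating-tail (A P) fs alt-f , all-f)
                                                   (Alternating-tail (A P′) gs alt-g , all-g) (proj₂ cancelled)
  where
  cancelled : P ≋ P′ × prod fs ≋ₘ prod gs
  cancelled = A-cancel P P′ (proj₁ (proj₁ gf)) (proj₁ (proj₁ gg))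
                (prod-SL₂𝕄₂ fs all-f) (prod-SL₂𝕄₂ gs all-g)
                (prod-tail-type (A P) fs alt-f all-f) (prod-tail-type (A P′) gs alt-g all-g) E
prod-injective (B Q ∷ fs) (B Q′ ∷ gs) (alt-f , gf ∷ all-f) (alt-g , gg ∷ all-g) E =
  coeff-≡ (proj₁ cancelled) ∷ prod-injective fs gs (Alternating-tail (B Q) fs alt-f , all-f)
                                                   (Alternating-tail (B Q′) gs alt-g , all-g) (proj₂ cancelled)
  where
  cancelled : Q ≋ Q′ × prod fs ≋ₘ prod gs
  cancelled = B-cancel Q Q′ (proj₁ (proj₁ gf)) (proj₁ (proj₁ gg))
                (prod-SL₂𝕄₂ fs all-f) (prod-SL₂𝕄₂ gs all-g)
                (prod-tail-type (B Q) fs alt-f all-f) (prod-tail-type (B Q′) gs alt-g all-g) E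

-- Existence

Deg≤ₘ : ℕ → Mat → Set
Deg≤ₘ n = Entrywise (Deg≤ n)

Deg≤ₘ-exists : ∀ M → ∃ λ n → Deg≤ₘ n M
Deg≤ₘ-exists M = (la ⊔ lb) ⊔ (lc ⊔ ld) , entrywise
  (bound (a M) (ℕP.m≤n⇒m≤n⊔o (lc ⊔ ld) (ℕP.m≤m⊔n la lb)))
  (bound (b M) (ℕP.m≤n⇒m≤n⊔o (lc ⊔ ld) (ℕP.m≤n⇒m≤o⊔n la ℕP.≤-refl)))
  (bound (c M) (ℕP.m≤n⇒m≤o⊔n (la ⊔ lb) (ℕP.m≤m⊔n lc ld)))
  (bound (d M) (ℕP.m≤n⇒m≤o⊔n (la ⊔ lb) (ℕP.m≤n⇒m≤o⊔n lc ℕP.≤-refl)))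
  where
  la lb lc ld : ℕ
  la = length (a M)
  lb = length (b M)
  lc = length (c M)
  ld = length (d M)
  bound : ∀ p {n} → length p ℕ.≤ n → Deg≤ n p
  bound p le = Deg≤-mono le (Deg≤-length p)

TopVanishes : ℕ → Mat → Set
TopVanishes n = Entrywise (λ p → coeff p n ≡ 0ℚ)

TopVanishes? : ∀ n M → Dec (TopVanishes n M)
TopVanishes? n M =
  Dec.map′ (λ (ea , eb , ec , ed) → entrywise ea eb ec ed) (λ (entrywise ea eb ec ed) → ea , eb , ec , ed)
           (zero? (a M) Dec.×-dec zero? (b M) Dec.×-dec zero? (c M) Dec.×-dec zero? (d M))
  where
  zero? : ∀ p → Dec (coeff p n ≡ 0ℚ)
  zero? p = coeff p n ℚP.≟ 0ℚ

Deg≤ₘ-pred : ∀ {n M} → SL₂𝕄₂ M → Deg≤ₘ n M → TopVanishes n M → ∃ λ n′ → n′ ℕ.< n × Deg≤ₘ n′ M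
Deg≤ₘ-pred {zero} {M} s (entrywise da db _ _) (entrywise za zb _ _) = ⊥-elim (Positive⇒≉0 Positive-1ₚ
  (≋-trans (≋-sym (det≋1 s))
           (+-cong (*-congˡ (d M) (Deg≤0⇒≋0 da za)) (·-congʳ (ℚ.- 1ℚ) (*-congˡ (c M) (Deg≤0⇒≋0 db zb))))))
Deg≤ₘ-pred {suc n} _ (entrywise da db dc dd) (entrywise za zb zc zd) =
  n , ℕP.n<1+n n , entrywise (Deg≤-pred da za) (Deg≤-pred db zb) (Deg≤-pred dc zc) (Deg≤-pred dd zd)

topSum : ℕ → Mat → ℚ
topSum n M = (coeff (a M) n ℚ.+ coeff (b M) n) ℚ.+ (coeff (c M) n ℚ.+ coeff (d M) n)

-- k clears the denominators of the degree-n coefficients, so peeling A¹ off a matrix whose c or d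
-- has degree n lowers the k-scaled sum of these coefficients by at least 1.
record Fuel (n k f : ℕ) (M : Mat) : Set where
  constructor mkFuel
  field
    denominators : Entrywise (λ p → ClearedBy k (coeff p n)) M
    bounded : topSum n M ℚ.* fromℕ k ℚ.≤ fromℕ f
open Fuel public

Fuel-resp : ∀ {n k f M N} → M ≋ₘ N → Fuel n k f M → Fuel n k f N
Fuel-resp {n} {k} {f} M≋N@(mk≋ₘ ea eb ec ed) (mkFuel cl bd) =
  mkFuel (Entrywise-resp (λ p≋q → subst (ClearedBy k) (coeff-≡ p≋q n)) M≋N cl)
         (subst (λ s → s ℚ.* fromℕ k ℚ.≤ fromℕ f)
                (cong₂ ℚ._+_ (cong₂ ℚ._+_ (coeff-≡ ea n) (coeff-≡ eb n)) (cong₂ ℚ._+_ (coeff-≡ ec n) (coeff-≡ ed n)))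
                bd)

Fuel-swap : ∀ {n k f M} → Fuel n k f M → Fuel n k f (swap M)
Fuel-swap {n} {k} {f} {M} (mkFuel cl bd) =
  mkFuel (Entrywise-swap cl)
         (subst (λ s → s ℚ.* fromℕ k ℚ.≤ fromℕ f) (reverse (coeff (a M) n) (coeff (b M) n) (coeff (c M) n) (coeff (d M) n))
                bd)
  where
  reverse : ∀ x y z w → (x ℚ.+ y) ℚ.+ (z ℚ.+ w) ≡ (w ℚ.+ z) ℚ.+ (y ℚ.+ x)
  reverse = solve-∀ ℚ-acr

initial-fuel : ∀ n M → ∃ λ k → ∃ λ f → 0 ℕ.< k × Fuel n k f M
initial-fuel n M = k , proj₁ (archimedean (topSum n M ℚ.* fromℕ k)) , k>0 ,
  mkFuel (entrywise (ClearedBy-*ʳ kd (ClearedBy-*ʳ kc (ClearedBy-*ʳ kb (ClearedBy-denominator (coeff (a M) n)))))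
                    (ClearedBy-*ʳ kd (ClearedBy-*ʳ kc (ClearedBy-*ˡ ka (ClearedBy-denominator (coeff (b M) n)))))
                    (ClearedBy-*ʳ kd (ClearedBy-*ˡ (ka ℕ.* kb) (ClearedBy-denominator (coeff (c M) n))))
                    (ClearedBy-*ˡ ((ka ℕ.* kb) ℕ.* kc) (ClearedBy-denominator (coeff (d M) n))))
         (ℚP.<⇒≤ (proj₂ (archimedean (topSum n M ℚ.* fromℕ k))))
  where
  ka kb kc kd k : ℕ
  ka = ℚ.↧ₙ coeff (a M) n
  kb = ℚ.↧ₙ coeff (b M) n
  kc = ℚ.↧ₙ coeff (c M) n
  kd = ℚ.↧ₙ coeff (d M) n
  k = ((ka ℕ.* kb) ℕ.* kc) ℕ.* kd
  k>0 : 0 ℕ.< k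
  k>0 = ℕ.>-nonZero⁻¹ k {{ℕP.m*n≢0 (ka ℕ.* kb ℕ.* kc) kd {{ℕP.m*n≢0 (ka ℕ.* kb) kc {{ℕP.m*n≢0 ka kb}}}}}}

topSum≥0 : ∀ {n M} → Entrywise NonNegative M → Deg≤ₘ n M → 0ℚ ℚ.≤ topSum n M
topSum≥0 (entrywise a≥0 b≥0 c≥0 d≥0) (entrywise da db dc dd) =
  nonNeg+nonNeg (nonNeg+nonNeg (coeff≥0 a≥0 da) (coeff≥0 b≥0 db))
                (nonNeg+nonNeg (coeff≥0 c≥0 dc) (coeff≥0 d≥0 dd))

data Smaller (D k : ℕ) : ℕ → Mat → Set where
  identity  : ∀ {f N} → N ≋ₘ Iₘ → Smaller D k f N
  lower     : ∀ {f N D′} → D′ ℕ.< D → Deg≤ₘ D′ N → Smaller D k f N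
  less-fuel : ∀ {f N} → Deg≤ₘ D N → Fuel D k f N → Smaller D k (suc f) N

Smaller-resp : ∀ {D k f N N′} → N ≋ₘ N′ → Smaller D k f N → Smaller D k f N′
Smaller-resp N≋N′ (identity N≋I)     = identity (≋ₘ-trans (≋ₘ-sym N≋N′) N≋I)
Smaller-resp N≋N′ (lower D′<D bound) = lower D′<D (Entrywise-resp Deg≤-resp N≋N′ bound)
Smaller-resp N≋N′ (less-fuel bound fuel) =
  less-fuel (Entrywise-resp Deg≤-resp N≋N′ bound) (Fuel-resp N≋N′ fuel)

Smaller-swap : ∀ {D k f N} → Smaller D k f N → Smaller D k f (swap N)
Smaller-swap (identity N≋I)         = identity (swap-cong N≋I)
Smaller-swap (lower D′<D bound)     = lower D′<D (Entrywise-swap bound)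
Smaller-swap (less-fuel bound fuel) = less-fuel (Entrywise-swap bound) (Fuel-swap fuel)

record Peeling (D k f : ℕ) (M : Mat) : Set where
  constructor mkPeeling
  field
    P       : Poly
    P∈      : 𝕄₂⁺ P
    Pc≤a    : P *ₚ c M ≤ₚ a M
    Pd≤b    : P *ₚ d M ≤ₚ b M
    smaller : Smaller D k f (peelA P M)

peel-upper-triangular : ∀ {D k f M} → SL₂𝕄₂ M → AType M → c M ≋ 0ₚ → Peeling D k f M
peel-upper-triangular {M = M} (mkSL₂𝕄₂ (entrywise a∈ b∈ c∈ d∈) det≋1) (mkAType _ d≤b) c≋0 =
  mkPeeling (b M) (mk𝕄₂⁺ (1≤ₚ⇒Positive (≤ₚ-resp d≋1 ≋-refl d≤b)) (intConst b∈))
            (≤ₚ-resp (≋-sym bc≋0) ≋-refl (NonNegative⇒0≤ₚ (nonNeg a∈))) (≤ₚ-reflexive bd≋b)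
            (identity (mk≋ₘ (+-cong a≋1 (·-congʳ (ℚ.- 1ℚ) bc≋0))
                            (≋-trans (+-cong ≋-refl (·-congʳ (ℚ.- 1ℚ) bd≋b)) (+-inverseʳ (b M))) c≋0 d≋1))
  where
  bc≋0 : b M *ₚ c M ≋ 0ₚ
  bc≋0 = ≋-trans (*-congʳ (b M) c≋0) (*-zeroʳ (b M))
  ad≋1 : a M *ₚ d M ≋ 1ₚ
  ad≋1 = ≋-trans (≋-sym (≋-trans (+-cong ≋-refl (·-congʳ (ℚ.- 1ℚ) bc≋0)) (+-identityʳ _))) det≋1
  a≋1 : a M ≋ 1ₚ
  a≋1 = 𝕄₂-unit a∈ d∈ ad≋1
  d≋1 : d M ≋ 1ₚ
  d≋1 = 𝕄₂-unit d∈ a∈ (≋-trans (*-comm (d M) (a M)) ad≋1)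
  bd≋b : b M *ₚ d M ≋ b M
  bd≋b = ≋-trans (*-congʳ (b M) d≋1) (≋-trans (*-comm (b M) 1ₚ) (*-identityˡ (b M)))

Fuel-decrease : ∀ {D k f M N x} → Fuel D k f M → Deg≤ₘ D N → Entrywise NonNegative N → 0 ℕ.< k →
                Entrywise (λ p → ClearedBy k (coeff p D)) N → topSum D N ℚ.+ x ≡ topSum D M →
                1ℚ ℚ.≤ x ℚ.* fromℕ k → Smaller D k f N
Fuel-decrease {D} {k} {f} {M} {N} {x} (mkFuel _ bounded) dN N≥0 k>0 clearedN sum≡ x≥1
  with fromℕ-bound-decrease f (trans (sym (ℚP.*-distribʳ-+ (fromℕ k) (topSum D N) x)) (cong (ℚ._* fromℕ k) sum≡))
                              x≥1 (nonNeg*pos (topSum≥0 N≥0 dN) (fromℕ-pos k>0)) bounded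
... | f′ , refl , bounded′ = less-fuel dN (mkFuel clearedN bounded′)

peel-one : ∀ {D k f M} → 0 ℕ.< k → SL₂𝕄₂ M → AType M → Deg≤ₘ D M → Fuel D k f M →
           0ℚ ℚ.< coeff (c M) D ℚ.+ coeff (d M) D → Peeling D k f M
peel-one {D} {k} {f} {M} k>0 (mkSL₂𝕄₂ (entrywise _ _ c∈ d∈) _) (mkAType c≤a d≤b) (entrywise da db dc dd)
         fuel@(mkFuel (entrywise ka kb kc kd) _) c+d>0 =
  mkPeeling 1ₚ (mk𝕄₂⁺ Positive-1ₚ IntConst-1ₚ)
            (≤ₚ-resp (≋-sym (*-identityˡ (c M))) ≋-refl c≤a)
            (≤ₚ-resp (≋-sym (*-identityˡ (d M))) ≋-refl d≤b)
    (Smaller-resp (≋ₘ-sym peeled≋N)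
      (Fuel-decrease fuel (entrywise (Deg≤-minus da dc) (Deg≤-minus db dd) dc dd)
                     (entrywise c≤a d≤b (nonNeg c∈) (nonNeg d∈)) k>0
                     (entrywise (cleared-minus (a M) (c M) ka kc) (cleared-minus (b M) (d M) kb kd) kc kd)
                     sum≡ (ClearedBy-pos⇒≥1 k>0 (ClearedBy-+ kc kd) c+d>0)))
  where
  N : Mat
  N = mat (a M -ₚ c M) (b M -ₚ d M) (c M) (d M)
  peeled≋N : peelA 1ₚ M ≋ₘ N
  peeled≋N = mk≋ₘ (+-cong ≋-refl (·-congʳ (ℚ.- 1ℚ) (*-identityˡ (c M))))
                  (+-cong ≋-refl (·-congʳ (ℚ.- 1ℚ) (*-identityˡ (d M)))) ≋-refl ≋-refl
  cleared-minus : ∀ p q → ClearedBy k (coeff p D) → ClearedBy k (coeff q D) → ClearedBy k (coeff (p -ₚ q) D)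
  cleared-minus p q kp kq = subst (ClearedBy k) (sym (coeff-minus p q D)) (ClearedBy-minus kp kq)
  regroup : ∀ x y z w → ((x ℚ.- z) ℚ.+ (y ℚ.- w)) ℚ.+ (z ℚ.+ w) ℚ.+ (z ℚ.+ w) ≡ (x ℚ.+ y) ℚ.+ (z ℚ.+ w)
  regroup = solve-∀ ℚ-acr
  sum≡ : topSum D N ℚ.+ (coeff (c M) D ℚ.+ coeff (d M) D) ≡ topSum D M
  sum≡ = trans (cong₂ (λ u v → (u ℚ.+ v) ℚ.+ (coeff (c M) D ℚ.+ coeff (d M) D)
                                          ℚ.+ (coeff (c M) D ℚ.+ coeff (d M) D))
                      (coeff-minus (a M) (c M) D) (coeff-minus (b M) (d M) D))
               (regroup (coeff (a M) D) (coeff (b M) D) (coeff (c M) D) (coeff (d M) D))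

-- P = μ X^(e+1) - T X^e: μ X^(e+1) cancels the top terms of a and b against P c and P d,
-- and the integer T is chosen so large that b - P d stays positive.
peel-monomial : ∀ {D k f M α β γ δ la lb lc ld} → SL₂𝕄₂ M →
  TopTerm α la (a M) → TopTerm β lb (b M) → TopTerm γ lc (c M) → TopTerm δ ld (d M) →
  0ℚ ℚ.< lb → 0ℚ ℚ.< ld → la ℚ.* ld ≡ lb ℚ.* lc →
  (∃ λ e → α ≡ suc e ℕ.+ γ × β ≡ suc e ℕ.+ δ) → α ℕ.≤ D → β ℕ.≤ D → Peeling D k f M
peel-monomial {M = M} {γ = γ} {δ} {la} {lb} {lc} {ld} s ta tb tc td lb>0 ld>0 cross (e , refl , refl) e+γ<D e+δ<D =
  mkPeeling P (mk𝕄₂⁺ (mkPositive μ>0 P-top) P-int) (inj₂ a′>0) (inj₂ b′>0)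
    (lower (ℕP.⊔-lub e+γ<D e+δ<D)
           (entrywise (Deg≤-mono ≤left a′-deg≤) (Deg≤-mono ≤right (deg≤ b′-top))
                      (Deg≤-mono (ℕP.≤-trans (ℕP.m≤n+m γ e) ≤left) (deg≤ tc))
                      (Deg≤-mono (ℕP.≤-trans (ℕP.m≤n+m δ e) ≤right) (deg≤ td))))
  where
  ≤left : e ℕ.+ γ ℕ.≤ (e ℕ.+ γ) ⊔ (e ℕ.+ δ)
  ≤left = ℕP.m≤m⊔n (e ℕ.+ γ) (e ℕ.+ δ)
  ≤right : e ℕ.+ δ ℕ.≤ (e ℕ.+ γ) ⊔ (e ℕ.+ δ)
  ≤right = ℕP.m≤n⊔m (e ℕ.+ γ) (e ℕ.+ δ)
  instance
    ld≢0 : ℚ.NonZero ld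
    ld≢0 = ℚ.>-nonZero ld>0
  μ : ℚ
  μ = lb ℚ.* ℚ.1/ ld
  μ>0 : 0ℚ ℚ.< μ
  μ>0 = pos*pos lb>0 (ℚP.positive⁻¹ _ {{ℚP.1/pos⇒pos ld {{ℚ.positive ld>0}}}})
  μld≡lb : μ ℚ.* ld ≡ lb
  μld≡lb = trans (ℚP.*-assoc lb (ℚ.1/ ld) ld) (trans (cong (lb ℚ.*_) (ℚP.*-inverseˡ ld)) (ℚP.*-identityʳ lb))
  swap₂₃ : ∀ x y z → x ℚ.* y ℚ.* z ≡ x ℚ.* z ℚ.* y
  swap₂₃ = solve-∀ ℚ-acr
  μlc≡la : μ ℚ.* lc ≡ la
  μlc≡la = *-cancelʳ-pos ld>0 (trans (swap₂₃ μ lc ld) (trans (cong (ℚ._* lc) μld≡lb) (sym cross)))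
  X Y P : Poly
  X = monomial μ (suc e)
  B₁ : Poly
  B₁ = b M -ₚ X *ₚ d M
  B₁-deg≤ : Deg≤ (e ℕ.+ δ) B₁
  B₁-deg≤ = Deg≤-cancel tb (subst (λ y → TopTerm (suc e ℕ.+ δ) y (X *ₚ d M)) μld≡lb
                                  (TopTerm-* (TopTerm-monomial μ (suc e)) td))
  x₀ : ℚ
  x₀ = coeff B₁ (e ℕ.+ δ)
  T : ℕ
  T = proj₁ (archimedean (ℚ.- x₀ ℚ.* ℚ.1/ ld))
  -x₀<Tld : ℚ.- x₀ ℚ.< fromℕ T ℚ.* ld
  -x₀<Tld = subst (ℚ._< fromℕ T ℚ.* ld) (trans (ℚP.*-assoc (ℚ.- x₀) (ℚ.1/ ld) ld)
                                        (trans (cong (ℚ.- x₀ ℚ.*_) (ℚP.*-inverseˡ ld)) (ℚP.*-identityʳ _)))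
                  (ℚP.*-monoˡ-<-pos ld {{ℚ.positive ld>0}} (proj₂ (archimedean (ℚ.- x₀ ℚ.* ℚ.1/ ld))))
  Y = monomial (fromℕ T) e
  P = X -ₚ Y
  P-top : TopTerm (suc e) μ P
  P-top = TopTerm-resp (+-comm (-ₚ Y) X)
            (TopTerm-+ˡ (ℕP.n<1+n e) (Deg≤-· (ℚ.- 1ℚ) (deg≤ (TopTerm-monomial (fromℕ T) e)))
                        (TopTerm-monomial μ (suc e)))
  P-int : IntConst P
  P-int = IntConst-minus X Y (IntConst-monomial-suc μ e) (IntConst-monomial e (+ T , refl))
  split : ∀ b X Y d → b -ₚ (X -ₚ Y) *ₚ d ≋ (b -ₚ X *ₚ d) +ₚ Y *ₚ d
  split = solve-∀ ℚ[X]-acr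
  b′-top : TopTerm (e ℕ.+ δ) (x₀ ℚ.+ fromℕ T ℚ.* ld) (b M -ₚ P *ₚ d M)
  b′-top = TopTerm-resp (≋-sym (split (b M) X Y (d M)))
             (TopTerm-+ (mkTopTerm B₁-deg≤ refl) (TopTerm-* (TopTerm-monomial (fromℕ T) e) td))
  b′>0 : Positive (b M -ₚ P *ₚ d M)
  b′>0 = mkPositive (subst (ℚ._< x₀ ℚ.+ fromℕ T ℚ.* ld) (ℚP.+-inverseʳ x₀) (ℚP.+-monoʳ-< x₀ -x₀<Tld)) b′-top
  a′-deg≤ : Deg≤ (e ℕ.+ γ) (a M -ₚ P *ₚ c M)
  a′-deg≤ = Deg≤-cancel ta (subst (λ y → TopTerm (suc e ℕ.+ γ) y (P *ₚ c M)) μlc≡la (TopTerm-* P-top tc))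
  a′>0 : Positive (a M -ₚ P *ₚ c M)
  a′>0 = det≋1⇒a>0 {peelA P M} (≋-trans (det-peelA P M) (det≋1 s))
                    (inj₂ b′>0) (nonNeg (on-c (entries s))) (SL₂𝕄₂⇒d>0 s)

peel-top : ∀ {D k f M} → SL₂𝕄₂ M →
           (a>0 : Positive (a M)) (b>0 : Positive (b M)) (c>0 : Positive (c M)) (d>0 : Positive (d M)) →
           degree c>0 ℕ.< D → degree d>0 ℕ.< D → degree a>0 ℕ.≤ D → degree b>0 ℕ.≤ D →
           degree a>0 ≡ D ⊎ degree b>0 ≡ D → Peeling D k f M
peel-top {D} s a>0 b>0 c>0 d>0 γ<D δ<D α≤D β≤D top-row =
  peel-monomial s (top a>0) (top b>0) (top c>0) (top d>0) (lead>0 b>0) (lead>0 d>0) (proj₂ agree) gap α≤D β≤D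
  where
  lead≢0 : ∀ {p q} (p>0 : Positive p) (q>0 : Positive q) → lead p>0 ℚ.* lead q>0 ≢ 0ℚ
  lead≢0 p>0 q>0 = >0⇒≢0 (pos*pos (lead>0 p>0) (lead>0 q>0))
  <D⇒0<sum : ∀ {m n} i → m ℕ.< D → i ≡ D → 0 ℕ.< i ℕ.+ n
  <D⇒0<sum {m} {n} i m<D refl = ℕP.<-≤-trans (ℕP.≤-<-trans ℕ.z≤n m<D) (ℕP.m≤m+n i n)
  agree : degree a>0 ℕ.+ degree d>0 ≡ degree b>0 ℕ.+ degree c>0 × lead a>0 ℚ.* lead d>0 ≡ lead b>0 ℚ.* lead c>0
  agree = TopTerm-agree (Deg≤-resp (≋-sym (det≋1 s)) (deg≤ TopTerm-1ₚ))
            (TopTerm-* (top a>0) (top d>0)) (TopTerm-* (top b>0) (top c>0)) (lead≢0 a>0 d>0) (lead≢0 b>0 c>0)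
            (Sum.map (<D⇒0<sum (degree a>0) γ<D) (<D⇒0<sum (degree b>0) δ<D) top-row)
  gap : ∃ λ e → degree a>0 ≡ suc e ℕ.+ degree c>0 × degree b>0 ≡ suc e ℕ.+ degree d>0
  gap = [ (λ α≡D → equal-gaps (subst (degree c>0 ℕ.<_) (sym α≡D) γ<D) (proj₁ agree))
        , (λ β≡D → Product.map₂ Product.swap
                     (equal-gaps (subst (degree d>0 ℕ.<_) (sym β≡D) δ<D) (sym (proj₁ agree)))) ]′ top-row

upper-row≢0 : ∀ {n M} → ¬ TopVanishes n M → coeff (c M) n ≡ 0ℚ → coeff (d M) n ≡ 0ℚ →
              coeff (a M) n ≢ 0ℚ ⊎ coeff (b M) n ≢ 0ℚ
upper-row≢0 {n} {M} top≢0 c[n]≡0 d[n]≡0 with coeff (a M) n ℚP.≟ 0ℚ | coeff (b M) n ℚP.≟ 0ℚ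
... | no a[n]≢0 | _         = inj₁ a[n]≢0
... | yes _     | no b[n]≢0 = inj₂ b[n]≢0
... | yes a[n]≡0 | yes b[n]≡0 = ⊥-elim (top≢0 (entrywise a[n]≡0 b[n]≡0 c[n]≡0 d[n]≡0))

peel-AType : ∀ {D k f M} → 0 ℕ.< k → SL₂𝕄₂ M → AType M → Deg≤ₘ D M → Fuel D k f M →
             ¬ TopVanishes D M → Peeling D k f M
peel-AType {D} {M = M} k>0 s at bound fuel top≢0 with trichotomy (c M)
... | inj₁ c≋0         = peel-upper-triangular s at c≋0
... | inj₂ (inj₂ -c>0) = ⊥-elim (NonNegative⇒¬Positive-neg (nonNeg (on-c (entries s))) -c>0)
... | inj₂ (inj₁ c>0)  with nonNeg+nonNeg-cases (coeff≥0 (nonNeg (on-c (entries s))) (on-c bound))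
                                               (coeff≥0 (nonNeg (on-d (entries s))) (on-d bound))
...   | inj₁ c+d>0 = peel-one k>0 s at bound fuel c+d>0
...   | inj₂ (c[D]≡0 , d[D]≡0) =
  peel-top s a>0 b>0 c>0 d>0 (degree< c>0 (on-c bound) c[D]≡0) (degree< d>0 (on-d bound) d[D]≡0)
           (degree≤ a>0 (on-a bound)) (degree≤ b>0 (on-b bound))
           (Sum.map (degree≡ a>0 (on-a bound)) (degree≡ b>0 (on-b bound)) (upper-row≢0 top≢0 c[D]≡0 d[D]≡0))
  where
  d>0 : Positive (d M)
  d>0 = SL₂𝕄₂⇒d>0 s
  a>0 : Positive (a M)
  a>0 = Positive-mono-≤ₚ c>0 (c≤a at)
  b>0 : Positive (b M)
  b>0 = Positive-mono-≤ₚ d>0 (d≤b at)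

Factorisation : Mat → Set
Factorisation M = Σ (List Factor) λ fs → ValidWord fs × prod fs ≋ₘ M

merge : Factor → List Factor → List Factor
merge f     []         = f ∷ []
merge (A P) (A P′ ∷ w) = A (P +ₚ P′) ∷ w
merge (A P) (B Q ∷ w)  = A P ∷ B Q ∷ w
merge (B Q) (A P ∷ w)  = B Q ∷ A P ∷ w
merge (B Q) (B Q′ ∷ w) = B (Q +ₚ Q′) ∷ w

prod-merge : ∀ f w → prod (merge f w) ≋ₘ toMat f *ₘ prod w
prod-merge f     []         = ≋ₘ-refl
prod-merge (A P) (A P′ ∷ w) = A-+ P P′ (prod w)
prod-merge (A P) (B Q ∷ w)  = ≋ₘ-refl
prod-merge (B Q) (A P ∷ w)  = ≋ₘ-refl
prod-merge (B Q) (B Q′ ∷ w) = B-+ Q Q′ (prod w)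

Alternating-head : ∀ f f′ w → SameForm f f′ → Alternating (f ∷ w) → Alternating (f′ ∷ w)
Alternating-head f     f′    []        _ _   = tt
Alternating-head (A _) (A _) (A _ ∷ w) _ alt = alt
Alternating-head (A _) (A _) (B _ ∷ w) _ alt = alt
Alternating-head (B _) (B _) (A _ ∷ w) _ alt = alt
Alternating-head (B _) (B _) (B _ ∷ w) _ alt = alt

ValidWord-merge : ∀ f w → 𝕄₂⁺ (param f) → ValidWord w → ValidWord (merge f w)
ValidWord-merge f [] f∈ _ = tt , 𝕄₂⁺⇒GoodFactor f f∈ ∷ []
ValidWord-merge (A P) (A P′ ∷ w) P∈ (alt , g ∷ gs) =
  Alternating-head (A P′) (A (P +ₚ P′)) w tt alt ,
  𝕄₂⁺⇒GoodFactor (A _) (𝕄₂⁺-+ P∈ (GoodFactor⇒𝕄₂⁺ (A P′) g)) ∷ gs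
ValidWord-merge (A P) (B Q ∷ w) P∈ (alt , gs) = ((λ ()) , alt) , 𝕄₂⁺⇒GoodFactor (A P) P∈ ∷ gs
ValidWord-merge (B Q) (A P ∷ w) Q∈ (alt , gs) = ((λ ()) , alt) , 𝕄₂⁺⇒GoodFactor (B Q) Q∈ ∷ gs
ValidWord-merge (B Q) (B Q′ ∷ w) Q∈ (alt , g ∷ gs) =
  Alternating-head (B Q′) (B (Q +ₚ Q′)) w tt alt ,
  𝕄₂⁺⇒GoodFactor (B _) (𝕄₂⁺-+ Q∈ (GoodFactor⇒𝕄₂⁺ (B Q′) g)) ∷ gs

prepend : ∀ f {M N} → 𝕄₂⁺ (param f) → M ≋ₘ toMat f *ₘ N → Factorisation N → Factorisation M
prepend f f∈ M≋fN (w , valid , w≋N) = merge f w , ValidWord-merge f w f∈ valid ,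
  ≋ₘ-trans (prod-merge f w) (≋ₘ-trans (*ₘ-congˡ (toMat f) w≋N) (≋ₘ-sym M≋fN))

Factorisable : ℕ → Set
Factorisable D = ∀ {M} → SL₂𝕄₂ M → Deg≤ₘ D M → Factorisation M

module _ {D : ℕ} (factorise-below : ∀ {D′} → D′ ℕ.< D → Factorisable D′) {k : ℕ} (k>0 : 0 ℕ.< k) where

  factorise-fuelled : ∀ f {M} → SL₂𝕄₂ M → Deg≤ₘ D M → Fuel D k f M → Factorisation M
  factorise-smaller : ∀ f {N} → SL₂𝕄₂ N → Smaller D k f N → Factorisation N
  factorise-peeling : ∀ f {M} → SL₂𝕄₂ M → Peeling D k f M → Factorisation M
  factorise-swapped : ∀ f {M} → SL₂𝕄₂ M → Peeling D k f (swap M) → Factorisation M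

  factorise-smaller _       _ (identity N≋I)         = [] , (tt , []) , ≋ₘ-sym N≋I
  factorise-smaller _       s (lower D′<D bound)     = factorise-below D′<D s bound
  factorise-smaller (suc f) s (less-fuel bound fuel) = factorise-fuelled f s bound fuel

  factorise-peeling f {M} s (mkPeeling P P∈ Pc≤a Pd≤b smaller) =
    prepend (A P) P∈ (≋ₘ-sym (A-peelA P M))
      (factorise-smaller f (SL₂𝕄₂-peelA P (intConst P∈) Pc≤a Pd≤b s) smaller)

  factorise-swapped f {M} s (mkPeeling P P∈ Pc≤a Pd≤b smaller) =
    prepend (B P) P∈ (≋ₘ-trans (swap-cong (≋ₘ-sym (A-peelA P (swap M)))) (swap-*ₘ (toMat (A P)) (peelA P (swap M))))
      (factorise-smaller f (SL₂𝕄₂-swap (SL₂𝕄₂-peelA P (intConst P∈) Pc≤a Pd≤b (SL₂𝕄₂-swap s)))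
                         (Smaller-swap smaller))

  factorise-fuelled f {M} s bound fuel with TopVanishes? D M
  ... | yes vanishes = factorise-below (proj₁ (proj₂ lowered)) s (proj₂ (proj₂ lowered))
    where
    lowered : ∃ λ D′ → D′ ℕ.< D × Deg≤ₘ D′ M
    lowered = Deg≤ₘ-pred s bound vanishes
  ... | no top≢0 with classify s
  ...   | inj₁ M≋I       = [] , (tt , []) , ≋ₘ-sym M≋I
  ...   | inj₂ (inj₁ at) = factorise-peeling f s (peel-AType k>0 s at bound fuel top≢0)
  ...   | inj₂ (inj₂ bt) = factorise-swapped f s
          (peel-AType k>0 (SL₂𝕄₂-swap s) bt (Entrywise-swap bound) (Fuel-swap fuel) (top≢0 ∘ Entrywise-swap))

factorise-at : ∀ D → (∀ {D′} → D′ ℕ.< D → Factorisable D′) → Factorisable D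
factorise-at D factorise-below {M} s bound =
  factorise-fuelled factorise-below (proj₁ (proj₂ (proj₂ fuelled))) (proj₁ (proj₂ fuelled)) s bound
                    (proj₂ (proj₂ (proj₂ fuelled)))
  where
  fuelled : ∃ λ k → ∃ λ f → 0 ℕ.< k × Fuel D k f M
  fuelled = initial-fuel D M

factorise : ∀ {M} → SL₂𝕄₂ M → Factorisation M
factorise {M} s = <-rec Factorisable factorise-at (proj₁ (Deg≤ₘ-exists M)) s (proj₂ (Deg≤ₘ-exists M))

≈ₘ⇒≋ₘ : ∀ {M N} → M ≈ₘ N → M ≋ₘ N
≈ₘ⇒≋ₘ (ea , eb , ec , ed) = mk≋ₘ (mk≋ ea) (mk≋ eb) (mk≋ ec) (mk≋ ed)

≋ₘ⇒≈ₘ : ∀ {M N} → M ≋ₘ N → M ≈ₘ N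
≋ₘ⇒≈ₘ (mk≋ₘ ea eb ec ed) = coeff-≡ ea , coeff-≡ eb , coeff-≡ ec , coeff-≡ ed

mainTheorem6 : (M : Mat) → EntriesInM₂ M → det M ≈ₚ 1ₚ →
    Σ (List Factor) (λ fs → ValidWord fs × prod fs ≈ₘ M)
    × ((fs gs : List Factor) → ValidWord fs → ValidWord gs →
        prod fs ≈ₘ M → prod gs ≈ₘ M → Pointwise _≈F_ fs gs)
mainTheorem6 M (a∈ , b∈ , c∈ , d∈) det≈1 = existence , uniqueness
  where
  s : SL₂𝕄₂ M
  s = mkSL₂𝕄₂ (entrywise (InM₂⇒𝕄₂ a∈) (InM₂⇒𝕄₂ b∈) (InM₂⇒𝕄₂ c∈) (InM₂⇒𝕄₂ d∈)) (mk≋ det≈1)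
  factorisation : Factorisation M
  factorisation = factorise s
  existence : Σ (List Factor) (λ fs → ValidWord fs × prod fs ≈ₘ M)
  existence = proj₁ factorisation , proj₁ (proj₂ factorisation) , ≋ₘ⇒≈ₘ (proj₂ (proj₂ factorisation))
  uniqueness : (fs gs : List Factor) → ValidWord fs → ValidWord gs →
               prod fs ≈ₘ M → prod gs ≈ₘ M → Pointwise _≈F_ fs gs
  uniqueness fs gs vf vg fs≈M gs≈M =
    prod-injective fs gs vf vg (≋ₘ-trans (≈ₘ⇒≋ₘ {prod fs} {M} fs≈M) (≋ₘ-sym (≈ₘ⇒≋ₘ {prod gs} {M} gs≈M)))
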